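{- Let $n_1$ and $n_2$ be Carmichael numbers with $\gcd(n_1,n_2)=1$, and let $n=n_1n_2$. (i) If $n_1$ and $n_2$ are both in class A and $n$ is a Carmichael number, then: $n$ is in class A if $\min\{v_2(n_1-1),v_2(n_2-1)\}>\max\{v_2(\lambda(n_1)),v_2(\lambda(n_2))\}$; $n$ is in class B1 if $\min\{v_2(n_1-1),v_2(n_2-1)\}=\max\{v_2(\lambda(n_1)),v_2(\lambda(n_2))\}$ and $v_2(n_1-1)\neq v_2(n_2-1)$. In all other cases (with $n_1,n_2$ both in class A), $n$ is not a Carmichael number. (ii) If $n_1$ is in class A, $n_2$ is in class B, and $n$ is a Carmichael number, then: $n$ is in class A if $v_2(n_1-1)=v_2(n_2-1)$; $n$ is in class B1 if $v_2(n_1-1)>v_2(n_2-1)$ and $v_2(\lambda(n_1))<v_2(\lambda(n_2))$; $n$ is in class B1 or B2 if $v_2(n_1-1)>v_2(n_2-1)$ and $v_2(\lambda(n_1))=v_2(\lambda(n_2))$. In all other cases (with $n_1$ in class A and $n_2$ in class B), $n$ is not a Carmichael number. (iii) If $n_1$ and $n_2$ are both in class B and $n$ is a Carmichael number, then $n$ is in class A if $v_2(n_1-1)=v_2(n_2-1)$. In all other cases (with $n_1,n_2$ both in class B), $n$ is not a Carmichael number.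
   Context: A Carmichael number is a composite integer $n$ with $a^{n-1}\equiv1\pmod n$ for all $a$ coprime to $n$; it is odd and squarefree, $n=\prod_{i=1}^k p_i$ with distinct odd primes $p_i$. $\lambda(n)$ is the Carmichael lambda function (smallest positive $\ell$ with $a^\ell\equiv1\pmod n$ for all $a\in\mathbb{Z}_n^*$), equal to $\mathrm{lcm}(p_i-1)$ for squarefree $n$ and dividing $n-1$ for Carmichael $n$. $v_2(m)$ is the largest $N$ with $2^N\mid m$. The index of a Carmichael number is $i(n)=(n-1)/\lambda(n)$. A Carmichael number is in class A if $i(n)$ is even and in class B if $i(n)$ is odd. For $n$ in class B, let $h$ be the number of prime factors $p_i$ of $n$ with $v_2(p_i-1)=v_2(\lambda(n))$; $n$ is in class B1 if $1\le h<k$ and in class B2 if $h=k$. -}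

module Defs where

open import Data.Nat using (ℕ; zero; suc; _+_; _*_; _∸_; _^_; _≤_; _<_; _≟_)
open import Data.Nat.DivMod using (_/_)
open import Data.Nat.Divisibility using (_∣_; _∣?_)
open import Data.Nat.Coprimality using (Coprime)
open import Data.Nat.Primality using (Prime; Composite; prime?)
open import Data.Product using (_×_; ∃; ∃-syntax)
open import Data.Sum using (_⊎_)
open import Data.Bool using (true; false)
open import Data.List using (List; filter; length; upTo)
open import Relation.Nullary using (¬_)
open import Relation.Nullary.Decidable using (_×-dec_; does)
open import Relation.Binary.PropositionalEquality using (_≡_)

-- a ≡ 1 (mod n), for a ≥ 1 (used only with a = b^e where b is coprime to n ≥ 2)
-- written as  n ∣ a ∸ 1 .
CongOne : ℕ → ℕ → Set
CongOne n a = n ∣ (a ∸ 1)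

Carmichael : ℕ → Set
Carmichael n = Composite n × (∀ a → Coprime a n → CongOne n (a ^ (n ∸ 1)))

IsLambda : ℕ → ℕ → Set
IsLambda n ℓ =
  (0 < ℓ) × (∀ a → Coprime a n → CongOne n (a ^ ℓ))
  × (∀ m → 0 < m → (∀ a → Coprime a n → CongOne n (a ^ m)) → ℓ ≤ m)

-- 2-adic valuation v₂(m): largest N with 2^N ∣ m (for m > 0), computed by
-- repeated halving with fuel m (which suffices since N ≤ m).  v₂ 0 = 0 by convention
-- (never used).
v2-fuel : ℕ → ℕ → ℕ
v2-fuel zero m = 0
v2-fuel (suc f) zero = 0
v2-fuel (suc f) (suc m) with does (2 ∣? suc m)
... | true  = suc (v2-fuel f (suc m / 2))
... | false = 0

v2 : ℕ → ℕ
v2 m = v2-fuel m m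

Even Odd : ℕ → Set
Even m = 2 ∣ m
Odd m = ¬ (2 ∣ m)

IsIndex : ℕ → ℕ → Set
IsIndex n ι = ∃[ ℓ ] (IsLambda n ℓ × n ∸ 1 ≡ ι * ℓ)

ClassA : ℕ → Set
ClassA n = ∃[ ι ] (IsIndex n ι × Even ι)

ClassB : ℕ → Set
ClassB n = ∃[ ι ] (IsIndex n ι × Odd ι)

numPrimeFactors : ℕ → ℕ
numPrimeFactors n = length (filter (λ p → prime? p ×-dec (p ∣? n)) (upTo (suc n)))

hCount : ℕ → ℕ → ℕ
hCount n ℓ = length (filter (λ p → prime? p ×-dec (p ∣? n) ×-dec (v2 (p ∸ 1) ≟ v2 ℓ))
                            (upTo (suc n)))

ClassB1 : ℕ → Set
ClassB1 n = ClassB n × ∃[ ℓ ] (IsLambda n ℓ × 1 ≤ hCount n ℓ × hCount n ℓ < numPrimeFactors n)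

ClassB2 : ℕ → Set
ClassB2 n = ClassB n × ∃[ ℓ ] (IsLambda n ℓ × hCount n ℓ ≡ numPrimeFactors n)

module Submission where

-- λ(n₁ n₂) = lcm (λ(n₁), λ(n₂)) for coprime factors, so v₂(λ(n)) = max (e₁, e₂) where eᵢ = v₂(λ(nᵢ)); and
-- n₁ n₂ - 1 = n₁ (n₂ - 1) + (n₁ - 1) shows that v₂(n - 1) = min (a₁, a₂) when aᵢ = v₂(nᵢ - 1) differ, while
-- v₂(n - 1) > a₁ when a₁ = a₂ (the nᵢ are odd).  Writing m - 1 = i(m) λ(m), the index is even exactly when
-- v₂(λ(m)) < v₂(m - 1), so the class of each factor pins eᵢ against aᵢ, and the class of n is decided by
-- comparing max (e₁, e₂) with v₂(n - 1).  If n is Carmichael then λ(n) ∣ n - 1, i.e. max (e₁, e₂) ≤ v₂(n - 1),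
-- which excludes the remaining cases.  Separating B1 from B2 uses that every prime p ∣ n has
-- v₂(p - 1) ≤ v₂(λ(n)) with equality for some p: this comes from Fermat's little theorem, a non-residue mod p
-- (found by counting roots of x ^ ((p - 1)/2) - 1) lifted to a unit mod n, and squarefreeness of n.

module Congruence where
  open import Data.Nat.Base as ℕ using (ℕ; zero; suc)
  import Data.Nat.Divisibility as ℕ
  import Data.Nat.Properties as ℕ
  open import Data.Integer.Base using (ℤ; +_; _+_; _*_; _-_; -_; _^_; ∣_∣; 0ℤ)
  import Data.Integer.Properties as ℤ
  open import Data.Integer.Divisibility.Signed
  open import Data.Integer.Tactic.RingSolver using (solve-∀)
  open import Data.Nat.Primality using (Prime; euclidsLemma)
  open import Data.Sum.Base using (inj₁; inj₂)
  open import Data.Empty using (⊥-elim)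
  open import Relation.Nullary.Negation using (¬_)
  open import Relation.Nullary.Decidable using (Dec; map′)
  open import Relation.Binary.Bundles using (Setoid)
  open import Relation.Binary.PropositionalEquality
  import Relation.Binary.Reasoning.Setoid as SetoidReasoning

  infix 4 _≡_[mod_]

  record _≡_[mod_] (x y : ℤ) (n : ℕ) : Set where
    constructor mod∣
    field modulus∣difference : + n ∣ x - y
  open _≡_[mod_] public

  private
    +x-+y≡+[x∸y] : ∀ {x y} → y ℕ.≤ x → + x - + y ≡ + (x ℕ.∸ y)
    +x-+y≡+[x∸y] {x} {y} y≤x = trans (ℤ.m-n≡m⊖n x y) (ℤ.⊖-≥ y≤x)

  module _ {n : ℕ} where

    ≡⇒≡[mod] : ∀ {x y} → x ≡ y → x ≡ y [mod n ]
    ≡⇒≡[mod] {x} refl = mod∣ (divides 0ℤ (trans (ℤ.+-inverseʳ x) (sym (ℤ.*-zeroˡ (+ n)))))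

    ≡[mod]-refl : ∀ {x} → x ≡ x [mod n ]
    ≡[mod]-refl = ≡⇒≡[mod] refl

    ≡[mod]-sym : ∀ {x y} → x ≡ y [mod n ] → y ≡ x [mod n ]
    ≡[mod]-sym {x} {y} (mod∣ d) = mod∣ (subst (+ n ∣_) (difference-swap x y) (∣m⇒∣-m d))
      where difference-swap : ∀ x y → - (x - y) ≡ y - x
            difference-swap = solve-∀

    ≡[mod]-trans : ∀ {x y z} → x ≡ y [mod n ] → y ≡ z [mod n ] → x ≡ z [mod n ]
    ≡[mod]-trans {x} {y} {z} (mod∣ d) (mod∣ e) = mod∣ (subst (+ n ∣_) (telescope x y z) (∣m∣n⇒∣m+n d e))
      where telescope : ∀ x y z → (x - y) + (y - z) ≡ x - z
            telescope = solve-∀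

    ≡[mod]-setoid : Setoid _ _
    ≡[mod]-setoid = record
      { Carrier = ℤ
      ; _≈_ = _≡_[mod n ]
      ; isEquivalence = record { refl = ≡[mod]-refl ; sym = ≡[mod]-sym ; trans = ≡[mod]-trans }
      }

    +-cong[mod] : ∀ {x y u v} → x ≡ y [mod n ] → u ≡ v [mod n ] → x + u ≡ y + v [mod n ]
    +-cong[mod] {x} {y} {u} {v} (mod∣ d) (mod∣ e) = mod∣ (subst (+ n ∣_) (regroup x y u v) (∣m∣n⇒∣m+n d e))
      where regroup : ∀ x y u v → (x - y) + (u - v) ≡ (x + u) - (y + v)
            regroup = solve-∀

    -cong[mod] : ∀ {x y u v} → x ≡ y [mod n ] → u ≡ v [mod n ] → x - u ≡ y - v [mod n ]
    -cong[mod] {x} {y} {u} {v} (mod∣ d) (mod∣ e) = mod∣ (subst (+ n ∣_) (regroup x y u v) (∣m∣n⇒∣m-n d e))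
      where regroup : ∀ x y u v → (x - y) - (u - v) ≡ (x - u) - (y - v)
            regroup = solve-∀

    *-cong[mod] : ∀ {x y u v} → x ≡ y [mod n ] → u ≡ v [mod n ] → x * u ≡ y * v [mod n ]
    *-cong[mod] {x} {y} {u} {v} (mod∣ d) (mod∣ e) =
      mod∣ (subst (+ n ∣_) (regroup x y u v) (∣m∣n⇒∣m+n (∣m⇒∣m*n u d) (∣n⇒∣m*n y e)))
      where regroup : ∀ x y u v → (x - y) * u + y * (u - v) ≡ x * u - y * v
            regroup = solve-∀

    ^-cong[mod] : ∀ {x y} k → x ≡ y [mod n ] → x ^ k ≡ y ^ k [mod n ]
    ^-cong[mod] zero    _   = ≡[mod]-refl
    ^-cong[mod] (suc k) x≡y = *-cong[mod] x≡y (^-cong[mod] k x≡y)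

    ∣⇒≡0[mod] : ∀ {c} → n ℕ.∣ c → + c ≡ 0ℤ [mod n ]
    ∣⇒≡0[mod] {c} n∣c = mod∣ (subst (+ n ∣_) (sym (ℤ.+-identityʳ (+ c))) (∣ᵤ⇒∣ n∣c))

    ∣∸⇒≡[mod] : ∀ {x y} → n ℕ.∣ x ℕ.∸ y → y ℕ.≤ x → + x ≡ + y [mod n ]
    ∣∸⇒≡[mod] {x} {y} d y≤x = mod∣ (subst (+ n ∣_) (sym (+x-+y≡+[x∸y] y≤x)) (∣ᵤ⇒∣ d))

    ≡[mod]⇒∣∸ : ∀ {x y} → + x ≡ + y [mod n ] → y ℕ.≤ x → n ℕ.∣ x ℕ.∸ y
    ≡[mod]⇒∣∸ {x} {y} (mod∣ d) y≤x = subst (n ℕ.∣_) (cong ∣_∣ (+x-+y≡+[x∸y] y≤x)) (∣⇒∣ᵤ d)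

    module ≡[mod]-Reasoning = SetoidReasoning ≡[mod]-setoid

  ≡[mod]-∣ : ∀ {m n x y} → m ℕ.∣ n → x ≡ y [mod n ] → x ≡ y [mod m ]
  ≡[mod]-∣ m∣n (mod∣ d) = mod∣ (∣-trans (∣ᵤ⇒∣ m∣n) d)

  *-cancel-prime-≡[mod] : ∀ {p u x y} → Prime p → ¬ (p ℕ.∣ ∣ u ∣) → u * x ≡ u * y [mod p ] → x ≡ y [mod p ]
  *-cancel-prime-≡[mod] {p} {u} {x} {y} prime-p p∤u (mod∣ p∣u[x-y])
    with euclidsLemma ∣ u ∣ ∣ x - y ∣ prime-p
           (subst (p ℕ.∣_) (ℤ.abs-* u (x - y)) (∣⇒∣ᵤ (subst (+ p ∣_) (factor u x y) p∣u[x-y])))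
    where factor : ∀ u x y → u * x - u * y ≡ u * (x - y)
          factor = solve-∀
  ... | inj₁ p∣u     = ⊥-elim (p∤u p∣u)
  ... | inj₂ p∣x-y   = mod∣ (∣ᵤ⇒∣ p∣x-y)

  infix 4 _≡?_[mod_]
  _≡?_[mod_] : ∀ x y n → Dec (x ≡ y [mod n ])
  x ≡? y [mod n ] = map′ mod∣ modulus∣difference (+ n ∣? x - y)

  private
    ≡[mod]∧≤⇒≡ : ∀ {n x y} → x ℕ.< n → y ℕ.≤ x → + x ≡ + y [mod n ] → x ≡ y
    ≡[mod]∧≤⇒≡ {n} {x} {y} x<n y≤x x≡y =
      ℕ.≤-antisym (ℕ.m∸n≡0⇒m≤n (small (≡[mod]⇒∣∸ x≡y y≤x) (ℕ.≤-<-trans (ℕ.m∸n≤m x y) x<n))) y≤x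
      where
      small : ∀ {k} → n ℕ.∣ k → k ℕ.< n → k ≡ 0
      small {zero}  _   _   = refl
      small {suc k} n∣k k<n = ⊥-elim (ℕ.<⇒≱ k<n (ℕ.∣⇒≤ n∣k))

  ≡[mod]⇒≡ : ∀ {n x y} → x ℕ.< n → y ℕ.< n → + x ≡ + y [mod n ] → x ≡ y
  ≡[mod]⇒≡ {n} {x} {y} x<n y<n x≡y with ℕ.≤-total y x
  ... | inj₁ y≤x = ≡[mod]∧≤⇒≡ x<n y≤x x≡y
  ... | inj₂ x≤y = sym (≡[mod]∧≤⇒≡ y<n x≤y (≡[mod]-sym x≡y))

module TwoAdic where
  open import Data.Nat
  open import Data.Nat.Properties
  open import Data.Nat.Divisibility
  open import Data.Nat.DivMod using (_/_; _%_; m*n/n≡m; m≡m%n+[m/n]*n; m%n<n)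
  open import Data.Nat.GCD using (gcd; gcd[m,n]∣m; gcd[m,n]∣n)
  open import Data.Nat.LCM using (lcm; m∣lcm[m,n]; n∣lcm[m,n]; lcm-least)
  open import Data.Nat.Primality using (euclidsLemma; prime[2])
  open import Data.Nat.Tactic.RingSolver using (solve-∀)
  open import Data.Bool.Base using (true; false; T)
  open import Data.Unit.Base using (tt)
  open import Data.Product
  open import Data.Sum.Base using (inj₁; inj₂)
  open import Data.Empty using (⊥-elim)
  open import Relation.Nullary
  open import Relation.Binary.PropositionalEquality
  open import Defs using (v2; v2-fuel; Odd)

  infix 4 2^_∥_

  record 2^_∥_ (k m : ℕ) : Set where
    constructor exactly
    field
      power∣ : 2 ^ k ∣ m
      next∤  : ¬ (2 ^ suc k ∣ m)
  open 2^_∥_ public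

  ^-monoʳ-∣ : ∀ b {m n} → m ≤ n → b ^ m ∣ b ^ n
  ^-monoʳ-∣ b {zero}  _         = 1∣ _
  ^-monoʳ-∣ b {suc m} (s≤s m≤n) = *-monoʳ-∣ b (^-monoʳ-∣ b m≤n)

  ∥-maximal : ∀ {m k e} → 2^ k ∥ m → 2 ^ e ∣ m → e ≤ k
  ∥-maximal {k = k} {e} (exactly _ ∤m) 2^e∣m with e ≤? k
  ... | yes e≤k = e≤k
  ... | no  e≰k = ⊥-elim (∤m (∣-trans (^-monoʳ-∣ 2 (≰⇒> e≰k)) 2^e∣m))

  ∥-unique : ∀ {m a b} → 2^ a ∥ m → 2^ b ∥ m → a ≡ b
  ∥-unique a∥m b∥m = ≤-antisym (∥-maximal b∥m (power∣ a∥m)) (∥-maximal a∥m (power∣ b∥m))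

  ∥-∤ : ∀ {m k e} → 2^ k ∥ m → k < e → ¬ (2 ^ e ∣ m)
  ∥-∤ (exactly _ ∤m) k<e 2^e∣m = ∤m (∣-trans (^-monoʳ-∣ 2 k<e) 2^e∣m)

  ∥-*2 : ∀ {m k} → 2^ k ∥ m → 2^ suc k ∥ m * 2
  ∥-*2 {m} {k} (exactly ∣m ∤m) =
    exactly (subst (2 ^ suc k ∣_) (*-comm 2 m) (*-monoʳ-∣ 2 ∣m))
            λ d → ∤m (*-cancelˡ-∣ 2 (subst (2 * 2 ^ suc k ∣_) (*-comm m 2) d))

  v2-fuel-∥ : ∀ f m → 0 < m → m ≤ f → 2^ v2-fuel f m ∥ m
  v2-fuel-∥ (suc f) (suc m) _ m<f with suc m % 2 ≡ᵇ 0 in even?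
  ... | false = exactly (1∣ _) λ 2∣m → subst T even? (≡⇒≡ᵇ _ _ (n∣m⇒m%n≡0 (suc m) 2 2∣m))
  ... | true  with m%n≡0⇒n∣m (suc m) 2 (≡ᵇ⇒≡ _ _ (subst T (sym even?) tt))
  ... | divides q m≡2q = subst₂ (λ h n → 2^ suc (v2-fuel f h) ∥ n) (sym half) (sym m≡2q)
                                (∥-*2 {k = v2-fuel f q} (v2-fuel-∥ f q 0<q q≤f))
    where
    half : suc m / 2 ≡ q
    half = trans (cong (_/ 2) m≡2q) (m*n/n≡m q 2)
    0<q : 0 < q
    0<q = n≢0⇒n>0 λ { refl → 1+n≢0 m≡2q }
    q≤f : q ≤ f
    q≤f = ≤-pred (≤-trans (m<m*n q 2 ⦃ >-nonZero 0<q ⦄ ≤-refl) (subst (_≤ suc f) m≡2q m<f))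

  v2-∥ : ∀ {m} → 0 < m → 2^ v2 m ∥ m
  v2-∥ {m} 0<m = v2-fuel-∥ m m 0<m ≤-refl

  odd-* : ∀ {a b} → Odd a → Odd b → Odd (a * b)
  odd-* {a} {b} odd-a odd-b 2∣ab with euclidsLemma a b prime[2] 2∣ab
  ... | inj₁ 2∣a = odd-a 2∣a
  ... | inj₂ 2∣b = odd-b 2∣b

  odd⇒≡1+2k : ∀ {a} → Odd a → ∃[ k ] a ≡ suc (k * 2)
  odd⇒≡1+2k {a} odd-a with a % 2 | m%n<n a 2 | m≡m%n+[m/n]*n a 2
  ... | zero        | _                 | a≡2k   = ⊥-elim (odd-a (divides (a / 2) a≡2k))
  ... | suc zero    | _                 | a≡1+2k = a / 2 , a≡1+2k
  ... | suc (suc _) | s≤s (s≤s ())    | _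

  odd+odd-even : ∀ {a b} → Odd a → Odd b → 2 ∣ a + b
  odd+odd-even odd-a odd-b with odd⇒≡1+2k odd-a | odd⇒≡1+2k odd-b
  ... | k , refl | l , refl = divides (suc (k + l)) (regroup k l)
    where regroup : ∀ k l → suc (k * 2) + suc (l * 2) ≡ suc (k + l) * 2
          regroup = solve-∀

  odd-*-∣ : ∀ {c g} e → Odd c → 2 ^ e ∣ c * g → 2 ^ e ∣ g
  odd-*-∣             zero    _     _       = 1∣ _
  odd-*-∣ {c} {g} (suc e) odd-c 2^e∣cg with euclidsLemma c g prime[2] (∣-trans (∣m⇒∣m*n (2 ^ e) ∣-refl) 2^e∣cg)
  ... | inj₁ 2∣c           = ⊥-elim (odd-c 2∣c)
  ... | inj₂ (divides h refl) =
    subst (2 ^ suc e ∣_) (*-comm 2 h) (*-monoʳ-∣ 2 (odd-*-∣ e odd-c (*-cancelˡ-∣ 2 (subst (2 * 2 ^ e ∣_) (regroup c h) 2^e∣cg))))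
    where regroup : ∀ c h → c * (h * 2) ≡ 2 * (c * h)
          regroup = solve-∀

  ∥-*-odd : ∀ {m k o} → 2^ k ∥ m → Odd o → 2^ k ∥ o * m
  ∥-*-odd {k = k} {o} (exactly ∣m ∤m) odd-o = exactly (∣n⇒∣m*n o ∣m) λ d → ∤m (odd-*-∣ (suc k) odd-o d)

  ∥⇒≡2^k*odd : ∀ {m k} → 2^ k ∥ m → ∃[ o ] m ≡ 2 ^ k * o × Odd o
  ∥⇒≡2^k*odd {m} {k} (exactly (divides o m≡o2^k) ∤m) =
    o , trans m≡o2^k (*-comm o (2 ^ k)) ,
    λ { (divides o′ refl) → ∤m (divides o′ (trans m≡o2^k (*-assoc o′ 2 (2 ^ k)))) }

  2^k∥2^k : ∀ k → 2^ k ∥ 2 ^ k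
  2^k∥2^k k = exactly ∣-refl λ d → <⇒≱ (2^k<2^[1+k] k) (∣⇒≤ ⦃ m^n≢0 2 k ⦄ d)
    where 2^k<2^[1+k] : ∀ k → 2 ^ k < 2 ^ suc k
          2^k<2^[1+k] k = ^-monoʳ-< 2 (s≤s (s≤s z≤n)) (n<1+n k)

  ∥-lcm : ∀ {x y a b} → 2^ a ∥ x → 2^ b ∥ y → 2^ a ⊔ b ∥ lcm x y
  ∥-lcm {x} {y} {a} {b} a∥x b∥y with ∥⇒≡2^k*odd a∥x | ∥⇒≡2^k*odd b∥y
  ... | o₁ , refl , odd-o₁ | o₂ , refl , odd-o₂ =
    exactly 2^[a⊔b]∣lcm λ d → next∤ multiple-∥ (∣-trans d (lcm-least x∣multiple y∣multiple))
    where
    2^[a⊔b]∣lcm : 2 ^ (a ⊔ b) ∣ lcm x y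
    2^[a⊔b]∣lcm with ⊔-sel a b
    ... | inj₁ a⊔b≡a = subst (λ t → 2 ^ t ∣ lcm x y) (sym a⊔b≡a) (∣-trans (power∣ a∥x) (m∣lcm[m,n] x y))
    ... | inj₂ a⊔b≡b = subst (λ t → 2 ^ t ∣ lcm x y) (sym a⊔b≡b) (∣-trans (power∣ b∥y) (n∣lcm[m,n] x y))
    multiple : ℕ
    multiple = 2 ^ (a ⊔ b) * (o₁ * o₂)
    multiple-∥ : 2^ a ⊔ b ∥ multiple
    multiple-∥ = subst (2^ a ⊔ b ∥_) (*-comm (o₁ * o₂) _) (∥-*-odd (2^k∥2^k (a ⊔ b)) (odd-* odd-o₁ odd-o₂))
    x∣multiple : x ∣ multiple
    x∣multiple = *-pres-∣ (^-monoʳ-∣ 2 (m≤m⊔n a b)) (∣m⇒∣m*n o₂ ∣-refl)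
    y∣multiple : y ∣ multiple
    y∣multiple = *-pres-∣ (^-monoʳ-∣ 2 (m≤n⊔m a b)) (∣n⇒∣m*n o₁ ∣-refl)

  *∸1≡ : ∀ {n₁ n₂} → 0 < n₁ → 0 < n₂ → n₁ * n₂ ∸ 1 ≡ n₁ * (n₂ ∸ 1) + (n₁ ∸ 1)
  *∸1≡ {suc x} {suc y} _ _ = regroup x y
    where regroup : ∀ x y → y + x * suc y ≡ suc x * y + x
          regroup = solve-∀

  ∥-*∸1-< : ∀ {n₁ n₂ a₁ a₂} → 0 < n₁ → 0 < n₂ → 2^ a₁ ∥ n₁ ∸ 1 → 2^ a₂ ∥ n₂ ∸ 1 → a₁ < a₂ →
            2^ a₁ ∥ n₁ * n₂ ∸ 1
  ∥-*∸1-< {n₁} {n₂} {a₁} 0<n₁ 0<n₂ (exactly ∣n₁∸1 ∤n₁∸1) a₂∥ a₁<a₂ =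
    subst (2^ a₁ ∥_) (sym (*∸1≡ 0<n₁ 0<n₂))
          (exactly (∣m∣n⇒∣m+n (∣-trans (^-monoʳ-∣ 2 (n≤1+n a₁)) 2^[1+a₁]∣) ∣n₁∸1)
                   λ d → ∤n₁∸1 (∣m+n∣m⇒∣n d 2^[1+a₁]∣))
    where
    2^[1+a₁]∣ : 2 ^ suc a₁ ∣ n₁ * (n₂ ∸ 1)
    2^[1+a₁]∣ = ∣n⇒∣m*n n₁ (∣-trans (^-monoʳ-∣ 2 a₁<a₂) (power∣ a₂∥))

  ∥-*∸1-> : ∀ {n₁ n₂ a₁ a₂} → 0 < n₁ → 0 < n₂ → 2^ a₁ ∥ n₁ ∸ 1 → 2^ a₂ ∥ n₂ ∸ 1 → a₂ < a₁ →
            2^ a₂ ∥ n₁ * n₂ ∸ 1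
  ∥-*∸1-> {n₁} {n₂} {a₂ = a₂} 0<n₁ 0<n₂ a₁∥ a₂∥ a₂<a₁ =
    subst (λ n → 2^ a₂ ∥ n ∸ 1) (*-comm n₂ n₁) (∥-*∸1-< 0<n₂ 0<n₁ a₂∥ a₁∥ a₂<a₁)

  ∥-*∸1-≡ : ∀ {n₁ n₂ a} → 0 < n₁ → 0 < n₂ → Odd n₁ → 2^ a ∥ n₁ ∸ 1 → 2^ a ∥ n₂ ∸ 1 →
            2 ^ suc a ∣ n₁ * n₂ ∸ 1
  ∥-*∸1-≡ {n₁} {n₂} {a} 0<n₁ 0<n₂ odd-n₁ a∥₁ a∥₂ with ∥⇒≡2^k*odd a∥₁ | ∥⇒≡2^k*odd a∥₂
  ... | o₁ , n₁∸1≡ , odd-o₁ | o₂ , n₂∸1≡ , odd-o₂ with odd+odd-even (odd-* odd-n₁ odd-o₂) odd-o₁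
  ... | divides k 2k≡ = divides k (begin
    n₁ * n₂ ∸ 1                   ≡⟨ *∸1≡ 0<n₁ 0<n₂ ⟩
    n₁ * (n₂ ∸ 1) + (n₁ ∸ 1)      ≡⟨ cong₂ (λ u v → n₁ * u + v) n₂∸1≡ n₁∸1≡ ⟩
    n₁ * (2 ^ a * o₂) + 2 ^ a * o₁ ≡⟨ factor n₁ (2 ^ a) o₂ o₁ ⟩
    2 ^ a * (n₁ * o₂ + o₁)        ≡⟨ cong (2 ^ a *_) 2k≡ ⟩
    2 ^ a * (k * 2)               ≡⟨ regroup (2 ^ a) k ⟩
    k * 2 ^ suc a                 ∎)
    where
    open ≡-Reasoning
    factor : ∀ n t o₂ o₁ → n * (t * o₂) + t * o₁ ≡ t * (n * o₂ + o₁)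
    factor = solve-∀
    regroup : ∀ t k → t * (k * 2) ≡ k * (2 * t)
    regroup = solve-∀

  common-divisor-∣-half : ∀ {g A B e} → g ∣ A → g ∣ B → 2 ^ e ∣ B → ¬ (2 ^ e ∣ A) →
                          ∃[ h ] B ≡ 2 * h × g ∣ h
  common-divisor-∣-half {g} {e = e} g∣A (divides c refl) 2^e∣B 2^e∤A with 2 ∣? c
  ... | yes (divides c′ refl) = c′ * g , regroup c′ g , ∣n⇒∣m*n c′ ∣-refl
    where regroup : ∀ c′ g → c′ * 2 * g ≡ 2 * (c′ * g)
          regroup = solve-∀
  ... | no  odd-c           = ⊥-elim (2^e∤A (∣-trans (odd-*-∣ e odd-c 2^e∣B) g∣A))

  gcd-∣-half : ∀ {A B} → 0 < A → 0 < B → v2 A < v2 B → ∃[ h ] B ≡ 2 * h × gcd A B ∣ h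
  gcd-∣-half {A} {B} 0<A 0<B vA<vB =
    common-divisor-∣-half {e = v2 B} (gcd[m,n]∣m A B) (gcd[m,n]∣n A B) (power∣ (v2-∥ 0<B)) (∥-∤ (v2-∥ 0<A) vA<vB)

module UnitPowers where
  open import Data.Nat.Base as ℕ using (ℕ; zero; suc)
  import Data.Nat.Properties as ℕ
  open import Data.Nat.Divisibility as ℕ using (divides; ∣-refl; n∣m*n)
  open import Data.Nat.Coprimality using (Coprime)
  open import Data.Nat.GCD using (gcd; gcd-GCD; module Bézout)
  open import Data.Integer.Base using (+_; _*_; _-_; _^_; 1ℤ)
  import Data.Integer.Properties as ℤ
  import Data.Integer.Divisibility.Signed as ℤ
  open import Data.Product using (_,_)
  open import Relation.Binary.PropositionalEquality
  open import Defs using (CongOne)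
  open Congruence

  pos-^ : ∀ a k → + (a ℕ.^ k) ≡ (+ a) ^ k
  pos-^ a zero    = refl
  pos-^ a (suc k) = trans (ℤ.pos-* a (a ℕ.^ k)) (cong (+ a *_) (pos-^ a k))

  ^-∣-≡1[mod] : ∀ {n x d k} → d ℕ.∣ k → x ^ d ≡ 1ℤ [mod n ] → x ^ k ≡ 1ℤ [mod n ]
  ^-∣-≡1[mod] {n} {x} {d} (divides q refl) x^d≡1 = begin
    x ^ (q ℕ.* d)  ≡⟨ cong (x ^_) (ℕ.*-comm q d) ⟩
    x ^ (d ℕ.* q)  ≡⟨ ℤ.^-*-assoc x d q ⟨
    (x ^ d) ^ q    ≈⟨ ^-cong[mod] q x^d≡1 ⟩
    1ℤ ^ q         ≡⟨ ℤ.^-zeroˡ q ⟩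
    1ℤ             ∎
    where open ≡[mod]-Reasoning

  ^-+-cancel-≡1[mod] : ∀ {n x} u v → x ^ u ≡ 1ℤ [mod n ] → x ^ (u ℕ.+ v) ≡ 1ℤ [mod n ] →
                       x ^ v ≡ 1ℤ [mod n ]
  ^-+-cancel-≡1[mod] {n} {x} u v x^u≡1 x^[u+v]≡1 = begin
    x ^ v          ≡⟨ ℤ.*-identityˡ (x ^ v) ⟨
    1ℤ * x ^ v     ≈⟨ *-cong[mod] x^u≡1 ≡[mod]-refl ⟨
    x ^ u * x ^ v  ≡⟨ ℤ.^-distribˡ-+-* x u v ⟨
    x ^ (u ℕ.+ v)  ≈⟨ x^[u+v]≡1 ⟩
    1ℤ             ∎
    where open ≡[mod]-Reasoning

  ^-gcd-≡1[mod] : ∀ {n x} m k → x ^ m ≡ 1ℤ [mod n ] → x ^ k ≡ 1ℤ [mod n ] →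
                  x ^ gcd m k ≡ 1ℤ [mod n ]
  ^-gcd-≡1[mod] {n} {x} m k x^m≡1 x^k≡1 with Bézout.identity (gcd-GCD m k)
  ... | Bézout.+- a b eq = ^-+-cancel-≡1[mod] (b ℕ.* k) (gcd m k) (^-∣-≡1[mod] (n∣m*n b) x^k≡1)
                             (subst (λ e → x ^ e ≡ 1ℤ [mod n ]) (trans (sym eq) (ℕ.+-comm (gcd m k) _))
                                    (^-∣-≡1[mod] (n∣m*n a) x^m≡1))
  ... | Bézout.-+ a b eq = ^-+-cancel-≡1[mod] (a ℕ.* m) (gcd m k) (^-∣-≡1[mod] (n∣m*n a) x^m≡1)
                             (subst (λ e → x ^ e ≡ 1ℤ [mod n ]) (trans (sym eq) (ℕ.+-comm (gcd m k) _))
                                    (^-∣-≡1[mod] (n∣m*n b) x^k≡1))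

  ≡1[mod]⇒CongOne : ∀ {n} a k → (+ a) ^ k ≡ 1ℤ [mod n ] → CongOne n (a ℕ.^ k)
  ≡1[mod]⇒CongOne {n} a k a^k≡1 with a ℕ.^ k in a^k≡
  ... | zero  = divides 0 refl
  ... | suc m = ≡[mod]⇒∣∸ (subst (_≡ 1ℤ [mod n ]) (trans (sym (pos-^ a k)) (cong +_ a^k≡)) a^k≡1) (ℕ.s≤s ℕ.z≤n)

  -- a ^ k = 0 forces a = 0, and then Coprime 0 n forces n = 1.
  CongOne⇒≡1[mod] : ∀ {n} a k → Coprime a n → CongOne n (a ℕ.^ k) → (+ a) ^ k ≡ 1ℤ [mod n ]
  CongOne⇒≡1[mod] {n} a k a⊥n n∣a^k∸1 with a ℕ.^ k in a^k≡
  ... | suc m = subst (_≡ 1ℤ [mod n ]) (trans (cong +_ (sym a^k≡)) (pos-^ a k))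
                      (∣∸⇒≡[mod] n∣a^k∸1 (ℕ.s≤s ℕ.z≤n))
  ... | zero with ℕ.m^n≡0⇒m≡0 a k a^k≡
  ... | refl with a⊥n (divides 0 refl , ∣-refl)
  ... | refl = mod∣ (ℤ.divides ((+ 0) ^ k - 1ℤ) (sym (ℤ.*-identityʳ _)))

module ChineseRemainder where
  open import Data.Nat.Base as ℕ using (ℕ)
  import Data.Nat.Properties as ℕ
  open import Data.Nat.Divisibility as ℕ using (∣1⇒≡1; m∣m*n; n∣m*n)
  open import Data.Nat.Coprimality using (Coprime; coprime-Bézout; coprime-divisor; coprime⇒gcd≡1)
  import Data.Nat.Coprimality as Coprime
  open import Data.Nat.GCD using (module Bézout)
  open import Data.Nat.LCM using (lcm; lcm-least; gcd*lcm)
  open import Data.Integer.Base using (+_; _+_; _*_; _-_; 0ℤ; 1ℤ; -1ℤ)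
  import Data.Integer.Properties as ℤ
  import Data.Integer.Divisibility.Signed as ℤ
  open import Data.Integer.Tactic.RingSolver using (solve-∀)
  open import Data.Product
  open import Relation.Binary.PropositionalEquality
  open Congruence

  private
    1+A≡q*m⇒A≡-1[mod] : ∀ {m A} q → 1 ℕ.+ A ≡ q ℕ.* m → + A ≡ -1ℤ [mod m ]
    1+A≡q*m⇒A≡-1[mod] {m} {A} q eq = mod∣ (ℤ.divides (+ q) (begin
      + A - -1ℤ      ≡⟨ ℤ.+-comm (+ A) 1ℤ ⟩
      + (1 ℕ.+ A)    ≡⟨ cong +_ eq ⟩
      + (q ℕ.* m)    ≡⟨ ℤ.pos-* q m ⟩
      + q * + m      ∎))
      where open ≡-Reasoning

    1+q*m≡A⇒A≡1[mod] : ∀ {m A} q → 1 ℕ.+ q ℕ.* m ≡ A → + A ≡ 1ℤ [mod m ]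
    1+q*m≡A⇒A≡1[mod] q refl = +-cong[mod] (≡[mod]-refl {x = 1ℤ}) (∣⇒≡0[mod] (n∣m*n q))

  crt-idempotent : ∀ {m₁ m₂} → Coprime m₁ m₂ → ∃[ e ] + e ≡ 1ℤ [mod m₁ ] × + e ≡ 0ℤ [mod m₂ ]
  crt-idempotent {m₁} {m₂} m₁⊥m₂ with coprime-Bézout m₁⊥m₂
  ... | Bézout.-+ x y eq = y ℕ.* m₂ , 1+q*m≡A⇒A≡1[mod] x eq , ∣⇒≡0[mod] (n∣m*n y)
  ... | Bézout.+- x y eq = t ℕ.* t , square (1+A≡q*m⇒A≡-1[mod] x eq) , square (∣⇒≡0[mod] (n∣m*n y))
    where
    t : ℕ
    t = y ℕ.* m₂
    square : ∀ {m c} → + t ≡ c [mod m ] → + (t ℕ.* t) ≡ c * c [mod m ]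
    square {m} {c} t≡c = subst (λ s → s ≡ c * c [mod m ]) (sym (ℤ.pos-* t t)) (*-cong[mod] t≡c t≡c)

  coprime-≡[mod] : ∀ {n a b} → + a ≡ + b [mod n ] → Coprime b n → Coprime a n
  coprime-≡[mod] {n} {a} {b} (mod∣ n∣a-b) b⊥n {i} (i∣a , i∣n) = b⊥n (ℤ.∣⇒∣ᵤ i∣b , i∣n)
    where
    i∣b : + i ℤ.∣ + b
    i∣b = subst (+ i ℤ.∣_) (a-[a-b]≡b (+ a) (+ b))
                (ℤ.∣m∣n⇒∣m-n (ℤ.∣ᵤ⇒∣ {i = + a} i∣a) (ℤ.∣-trans (ℤ.∣ᵤ⇒∣ i∣n) n∣a-b))
      where a-[a-b]≡b : ∀ a b → a - (a - b) ≡ b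
            a-[a-b]≡b = solve-∀

  coprime-* : ∀ {a m n} → Coprime a m → Coprime a n → Coprime a (m ℕ.* n)
  coprime-* {a} {m} {n} a⊥m a⊥n {i} (i∣a , i∣mn) = a⊥n (i∣a , coprime-divisor i⊥m i∣mn)
    where
    i⊥m : Coprime i m
    i⊥m (j∣i , j∣m) = a⊥m (ℕ.∣-trans j∣i i∣a , j∣m)

  coprime-*ˡ : ∀ {a m n} → Coprime a (m ℕ.* n) → Coprime a m
  coprime-*ˡ {n = n} a⊥mn (i∣a , i∣m) = a⊥mn (i∣a , ℕ.∣-trans i∣m (m∣m*n n))

  coprime-*ʳ : ∀ {a m n} → Coprime a (m ℕ.* n) → Coprime a n
  coprime-*ʳ {m = m} a⊥mn (i∣a , i∣n) = a⊥mn (i∣a , ℕ.∣-trans i∣n (n∣m*n m))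

  coprime⇒*∣ : ∀ {m n x} → Coprime m n → m ℕ.∣ x → n ℕ.∣ x → m ℕ.* n ℕ.∣ x
  coprime⇒*∣ {m} {n} {x} m⊥n m∣x n∣x = subst (ℕ._∣ x) lcm≡m*n (lcm-least m∣x n∣x)
    where
    lcm≡m*n : lcm m n ≡ m ℕ.* n
    lcm≡m*n = trans (sym (ℕ.*-identityˡ (lcm m n)))
                    (trans (cong (ℕ._* lcm m n) (sym (coprime⇒gcd≡1 m⊥n))) (gcd*lcm m n))

  crt-lift : ∀ {m₁ m₂ a} → Coprime m₁ m₂ → Coprime a m₁ →
             ∃[ a′ ] Coprime a′ (m₁ ℕ.* m₂) × + a′ ≡ + a [mod m₁ ]
  crt-lift {m₁} {m₂} {a} m₁⊥m₂ a⊥m₁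
    with crt-idempotent m₁⊥m₂ | crt-idempotent (Coprime.sym m₁⊥m₂)
  ... | e₁ , e₁≡1 , e₁≡0 | e₂ , e₂≡1 , e₂≡0 =
    a′ , coprime-* (coprime-≡[mod] a′≡a a⊥m₁) (coprime-≡[mod] a′≡1 (λ (i∣1 , _) → ∣1⇒≡1 i∣1)) , a′≡a
    where
    a′ : ℕ
    a′ = a ℕ.* e₁ ℕ.+ e₂
    +a′≡ : + a′ ≡ + a * + e₁ + + e₂
    +a′≡ = trans (ℤ.pos-+ (a ℕ.* e₁) e₂) (cong (_+ + e₂) (ℤ.pos-* a e₁))
    a′≡a : + a′ ≡ + a [mod m₁ ]
    a′≡a = begin
      + a′                 ≡⟨ +a′≡ ⟩
      + a * + e₁ + + e₂    ≈⟨ +-cong[mod] (*-cong[mod] (≡[mod]-refl {x = + a}) e₁≡1) e₂≡0 ⟩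
      + a * 1ℤ + 0ℤ        ≡⟨ trans (ℤ.+-identityʳ _) (ℤ.*-identityʳ (+ a)) ⟩
      + a                  ∎
      where open ≡[mod]-Reasoning
    a′≡1 : + a′ ≡ + 1 [mod m₂ ]
    a′≡1 = begin
      + a′                 ≡⟨ +a′≡ ⟩
      + a * + e₁ + + e₂    ≈⟨ +-cong[mod] (*-cong[mod] (≡[mod]-refl {x = + a}) e₁≡0) e₂≡1 ⟩
      + a * 0ℤ + 1ℤ        ≡⟨ cong (_+ 1ℤ) (ℤ.*-zeroʳ (+ a)) ⟩
      1ℤ                   ∎
      where open ≡[mod]-Reasoning

module CarmichaelFunction where
  open import Data.Nat.Base as ℕ using (ℕ; >-nonZero)
  import Data.Nat.Properties as ℕ
  open import Data.Nat.Divisibility as ℕ using (∣⇒≤; m∣m*n)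
  open import Data.Nat.Coprimality using (Coprime)
  import Data.Nat.Coprimality as Coprime
  open import Data.Nat.GCD using (gcd; gcd[m,n]∣m; gcd[m,n]∣n; gcd[m,n]≢0)
  open import Data.Nat.LCM using (lcm; m∣lcm[m,n]; n∣lcm[m,n]; lcm-least; gcd*lcm)
  open import Data.Integer.Base using (+_; _^_; 1ℤ)
  open import Data.Product
  open import Data.Sum.Base using (inj₁)
  open import Relation.Binary.PropositionalEquality
  open import Defs using (CongOne; IsLambda; Carmichael)
  open Congruence
  open UnitPowers
  open ChineseRemainder

  Annihilates : ℕ → ℕ → Set
  Annihilates n m = ∀ a → Coprime a n → CongOne n (a ℕ.^ m)

  annihilates⇒≡1[mod] : ∀ {n a} m → Annihilates n m → Coprime a n → (+ a) ^ m ≡ 1ℤ [mod n ]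
  annihilates⇒≡1[mod] {a = a} m ann a⊥n = CongOne⇒≡1[mod] a m a⊥n (ann a a⊥n)

  annihilates-gcd : ∀ {n} m k → Annihilates n m → Annihilates n k → Annihilates n (gcd m k)
  annihilates-gcd m k ann-m ann-k a a⊥n =
    ≡1[mod]⇒CongOne a (gcd m k) (^-gcd-≡1[mod] m k (annihilates⇒≡1[mod] m ann-m a⊥n) (annihilates⇒≡1[mod] k ann-k a⊥n))

  annihilates-∣ : ∀ {n d k} → d ℕ.∣ k → Annihilates n d → Annihilates n k
  annihilates-∣ {d = d} {k} d∣k ann-d a a⊥n = ≡1[mod]⇒CongOne a k (^-∣-≡1[mod] d∣k (annihilates⇒≡1[mod] d ann-d a⊥n))

  λ∣annihilator : ∀ {n ℓ m} → IsLambda n ℓ → Annihilates n m → ℓ ℕ.∣ m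
  λ∣annihilator {n} {ℓ} {m} (0<ℓ , ann-ℓ , minimal) ann-m = subst (ℕ._∣ m) (sym ℓ≡gcd) (gcd[m,n]∣n ℓ m)
    where
    0<gcd : 0 ℕ.< gcd ℓ m
    0<gcd = ℕ.n≢0⇒n>0 (gcd[m,n]≢0 ℓ m (inj₁ (ℕ.>⇒≢ 0<ℓ)))
    ℓ≡gcd : ℓ ≡ gcd ℓ m
    ℓ≡gcd = ℕ.≤-antisym (minimal (gcd ℓ m) 0<gcd (annihilates-gcd ℓ m ann-ℓ ann-m))
                        (∣⇒≤ ⦃ >-nonZero 0<ℓ ⦄ (gcd[m,n]∣m ℓ m))

  λ-unique : ∀ {n ℓ ℓ′} → IsLambda n ℓ → IsLambda n ℓ′ → ℓ ≡ ℓ′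
  λ-unique (0<ℓ , ann-ℓ , minimal) (0<ℓ′ , ann-ℓ′ , minimal′) =
    ℕ.≤-antisym (minimal _ 0<ℓ′ ann-ℓ′) (minimal′ _ 0<ℓ ann-ℓ)

  λ∣n∸1 : ∀ {n ℓ} → Carmichael n → IsLambda n ℓ → ℓ ℕ.∣ n ℕ.∸ 1
  λ∣n∸1 (_ , ann-n∸1) λ-n = λ∣annihilator λ-n ann-n∸1

  annihilates-*⇒ˡ : ∀ {n₁ n₂ m} → Coprime n₁ n₂ → Annihilates (n₁ ℕ.* n₂) m → Annihilates n₁ m
  annihilates-*⇒ˡ {n₁} {n₂} {m} n₁⊥n₂ ann a a⊥n₁ = lifted (crt-lift n₁⊥n₂ a⊥n₁)
    where
    lifted : ∃[ a′ ] Coprime a′ (n₁ ℕ.* n₂) × + a′ ≡ + a [mod n₁ ] → CongOne n₁ (a ℕ.^ m)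
    lifted (a′ , a′⊥n , a′≡a) = ≡1[mod]⇒CongOne a m (begin
      (+ a) ^ m   ≈⟨ ^-cong[mod] m a′≡a ⟨
      (+ a′) ^ m  ≈⟨ ≡[mod]-∣ (m∣m*n n₂) (annihilates⇒≡1[mod] m ann a′⊥n) ⟩
      1ℤ          ∎)
      where open ≡[mod]-Reasoning

  annihilates-*⇒ʳ : ∀ {n₁ n₂ m} → Coprime n₁ n₂ → Annihilates (n₁ ℕ.* n₂) m → Annihilates n₂ m
  annihilates-*⇒ʳ {n₁} {n₂} {m} n₁⊥n₂ ann =
    annihilates-*⇒ˡ {m = m} (Coprime.sym n₁⊥n₂) (subst (λ n → Annihilates n m) (ℕ.*-comm n₁ n₂) ann)

  annihilates-* : ∀ {n₁ n₂ m} → Coprime n₁ n₂ → Annihilates n₁ m → Annihilates n₂ m → Annihilates (n₁ ℕ.* n₂) m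
  annihilates-* {n₁} {n₂} n₁⊥n₂ ann₁ ann₂ a a⊥n =
    coprime⇒*∣ n₁⊥n₂ (ann₁ a (coprime-*ˡ {n = n₂} a⊥n)) (ann₂ a (coprime-*ʳ {m = n₁} a⊥n))

  λ-* : ∀ {n₁ n₂ ℓ₁ ℓ₂} → Coprime n₁ n₂ → IsLambda n₁ ℓ₁ → IsLambda n₂ ℓ₂ →
        IsLambda (n₁ ℕ.* n₂) (lcm ℓ₁ ℓ₂)
  λ-* {ℓ₁ = ℓ₁} {ℓ₂} n₁⊥n₂ λ₁@(0<ℓ₁ , ann₁ , _) λ₂@(0<ℓ₂ , ann₂ , _) =
    0<lcm ,
    annihilates-* {m = lcm ℓ₁ ℓ₂} n₁⊥n₂ (annihilates-∣ (m∣lcm[m,n] ℓ₁ ℓ₂) ann₁) (annihilates-∣ (n∣lcm[m,n] ℓ₁ ℓ₂) ann₂) ,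
    λ m 0<m ann → ∣⇒≤ ⦃ >-nonZero 0<m ⦄
      (lcm-least (λ∣annihilator λ₁ (annihilates-*⇒ˡ {m = m} n₁⊥n₂ ann))
                 (λ∣annihilator λ₂ (annihilates-*⇒ʳ {m = m} n₁⊥n₂ ann)))
    where
    0<lcm : 0 ℕ.< lcm ℓ₁ ℓ₂
    0<lcm = ℕ.n≢0⇒n>0 λ lcm≡0 → ℕ.>⇒≢ (ℕ.*-mono-< 0<ℓ₁ 0<ℓ₂)
      (trans (sym (gcd*lcm ℓ₁ ℓ₂)) (trans (cong (gcd ℓ₁ ℓ₂ ℕ.*_) lcm≡0) (ℕ.*-zeroʳ (gcd ℓ₁ ℓ₂))))

module Fermat where
  open Congruence
  open UnitPowers using (pos-^)
  open import Data.Nat.Base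
  open import Data.Nat.Properties
  open import Data.Nat.Divisibility
  open import Data.Nat.Combinatorics using (_C_; nCn≡1; nC1≡n; k>n⇒nCk≡0; nCk+nC[k+1]≡[n+1]C[k+1])
  open import Data.Nat.Primality using (Prime; euclidsLemma)
  open import Data.Integer.Base as ℤ using (+_; 0ℤ; 1ℤ)
  import Data.Integer.Properties as ℤ
  open import Relation.Nullary.Negation using (¬_)
  open import Data.Nat.Tactic.RingSolver using (solve-∀)
  open import Data.Sum.Base using (inj₁; inj₂)
  open import Data.Empty using (⊥-elim)
  open import Relation.Binary.PropositionalEquality

  [k+1]*[n+1]C[k+1]≡[n+1]*nCk : ∀ n k → suc k * (suc n C suc k) ≡ suc n * (n C k)
  [k+1]*[n+1]C[k+1]≡[n+1]*nCk zero    zero    = refl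
  [k+1]*[n+1]C[k+1]≡[n+1]*nCk zero    (suc k) =
    trans (cong (suc (suc k) *_) (k>n⇒nCk≡0 {1} {suc (suc k)} (s≤s (s≤s z≤n)))) (*-zeroʳ (suc (suc k)))
  [k+1]*[n+1]C[k+1]≡[n+1]*nCk (suc n) zero    = trans (*-identityˡ _) (trans (nC1≡n (suc (suc n))) (sym (*-identityʳ _)))
  [k+1]*[n+1]C[k+1]≡[n+1]*nCk (suc n) (suc k) = begin
    2+k * (2+n C 2+k)                               ≡⟨ cong (2+k *_) (nCk+nC[k+1]≡[n+1]C[k+1] (suc n) (suc k)) ⟨
    2+k * (1+n C 1+k + 1+n C 2+k)                   ≡⟨ regroup (suc k) (1+n C 1+k) (1+n C 2+k) ⟩
    1+k * (1+n C 1+k) + 1+n C 1+k + 2+k * (1+n C 2+k)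
      ≡⟨ cong₂ (λ a b → a + 1+n C 1+k + b) ([k+1]*[n+1]C[k+1]≡[n+1]*nCk n k) ([k+1]*[n+1]C[k+1]≡[n+1]*nCk n (suc k)) ⟩
    1+n * (n C k) + 1+n C 1+k + 1+n * (n C 1+k)
      ≡⟨ cong (λ c → 1+n * (n C k) + c + 1+n * (n C 1+k)) (nCk+nC[k+1]≡[n+1]C[k+1] n k) ⟨
    1+n * (n C k) + (n C k + n C 1+k) + 1+n * (n C 1+k) ≡⟨ regroup′ (suc n) (n C k) (n C 1+k) ⟩
    2+n * (n C k + n C 1+k)                         ≡⟨ cong (2+n *_) (nCk+nC[k+1]≡[n+1]C[k+1] n k) ⟩
    2+n * (1+n C 1+k)                               ∎
    where
    open ≡-Reasoning
    1+n 2+n 1+k 2+k : ℕ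
    1+n = suc n
    2+n = suc (suc n)
    1+k = suc k
    2+k = suc (suc k)
    regroup : ∀ k a b → suc k * (a + b) ≡ k * a + a + suc k * b
    regroup = solve-∀
    regroup′ : ∀ m a b → m * a + (a + b) + m * b ≡ suc m * (a + b)
    regroup′ = solve-∀

  prime∣C : ∀ {p k} → Prime p → 0 < k → k < p → p ∣ p C k
  prime∣C {suc p} {suc k} prime-p _ (s≤s k<p)
    with euclidsLemma (suc k) (suc p C suc k) prime-p (divides (p C k) (trans ([k+1]*[n+1]C[k+1]≡[n+1]*nCk p k) (*-comm (suc p) _)))
  ... | inj₁ p∣1+k = ⊥-elim (<⇒≱ (s≤s k<p) (∣⇒≤ p∣1+k))
  ... | inj₂ p∣C   = p∣C

  binomialPrefix : ℕ → ℕ → ℕ → ℕ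
  binomialPrefix x n zero    = 1
  binomialPrefix x n (suc m) = binomialPrefix x n m + (n C suc m) * x ^ suc m

  binomialPrefix-pascal : ∀ x n m →
    binomialPrefix x (suc n) (suc m) ≡ binomialPrefix x n (suc m) + x * binomialPrefix x n m
  binomialPrefix-pascal x n zero =
    trans (cong (λ c → 1 + c * x ^ 1) (sym (nCk+nC[k+1]≡[n+1]C[k+1] n 0))) (regroup (n C 1) x)
    where regroup : ∀ c x → 1 + (1 + c) * (x * 1) ≡ 1 + c * (x * 1) + x * 1
          regroup = solve-∀
  binomialPrefix-pascal x n (suc m) = begin
    B (suc n) (suc m) + (suc n C suc (suc m)) * x ^ suc (suc m)
      ≡⟨ cong₂ (λ b c → b + c * x ^ suc (suc m)) (binomialPrefix-pascal x n m)
               (sym (nCk+nC[k+1]≡[n+1]C[k+1] n (suc m))) ⟩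
    B n (suc m) + x * B n m + ((n C suc m) + (n C suc (suc m))) * (x * x ^ suc m)
      ≡⟨ regroup (B n m) (n C suc m) (n C suc (suc m)) x (x ^ suc m) ⟩
    B n m + (n C suc m) * x ^ suc m + (n C suc (suc m)) * (x * x ^ suc m) + x * (B n m + (n C suc m) * x ^ suc m) ∎
    where
    open ≡-Reasoning
    B : ℕ → ℕ → ℕ
    B = binomialPrefix x
    regroup : ∀ b c d x y → b + c * y + x * b + (c + d) * (x * y) ≡ b + c * y + d * (x * y) + x * (b + c * y)
    regroup = solve-∀

  binomial-theorem : ∀ x n → (1 + x) ^ n ≡ binomialPrefix x n n
  binomial-theorem x zero    = refl
  binomial-theorem x (suc n) = begin
    (1 + x) * (1 + x) ^ n                      ≡⟨ cong ((1 + x) *_) (binomial-theorem x n) ⟩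
    (1 + x) * B n n                            ≡⟨ regroup (B n n) x (x ^ suc n) ⟩
    B n n + 0 * x ^ suc n + x * B n n          ≡⟨ cong (λ c → B n n + c * x ^ suc n + x * B n n) (k>n⇒nCk≡0 (n<1+n n)) ⟨
    B n (suc n) + x * B n n                    ≡⟨ binomialPrefix-pascal x n n ⟨
    B (suc n) (suc n)                          ∎
    where
    open ≡-Reasoning
    B : ℕ → ℕ → ℕ
    B = binomialPrefix x
    regroup : ∀ b x y → (1 + x) * b ≡ b + 0 * y + x * b
    regroup = solve-∀

  binomialPrefix≡1[mod] : ∀ {p} x m → Prime p → m < p → + binomialPrefix x p m ≡ 1ℤ [mod p ]
  binomialPrefix≡1[mod]     x zero    _       _   = ≡[mod]-refl
  binomialPrefix≡1[mod] {p} x (suc m) prime-p m<p = begin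
    + (B p m + (p C suc m) * x ^ suc m)     ≡⟨ ℤ.pos-+ (B p m) _ ⟩
    + B p m ℤ.+ + ((p C suc m) * x ^ suc m) ≈⟨ +-cong[mod] (binomialPrefix≡1[mod] x m prime-p (<-trans (n<1+n m) m<p))
                                                            (∣⇒≡0[mod] (∣m⇒∣m*n (x ^ suc m) (prime∣C prime-p (s≤s z≤n) m<p))) ⟩
    1ℤ ℤ.+ 0ℤ                               ≡⟨⟩
    1ℤ                                      ∎
    where
    open ≡[mod]-Reasoning
    B : ℕ → ℕ → ℕ
    B = binomialPrefix x

  freshmans-dream : ∀ {p} x → Prime p → + ((1 + x) ^ p) ≡ 1ℤ ℤ.+ + (x ^ p) [mod p ]
  freshmans-dream {suc p} x prime-p = begin
    + ((1 + x) ^ suc p)                                   ≡⟨ cong +_ (binomial-theorem x (suc p)) ⟩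
    + (B p + (suc p C suc p) * x ^ suc p)                 ≡⟨ ℤ.pos-+ (B p) _ ⟩
    + B p ℤ.+ + ((suc p C suc p) * x ^ suc p)             ≈⟨ +-cong[mod] (binomialPrefix≡1[mod] x p prime-p ≤-refl) (≡[mod]-refl {x = + _}) ⟩
    1ℤ ℤ.+ + ((suc p C suc p) * x ^ suc p)                ≡⟨ cong (λ c → 1ℤ ℤ.+ + (c * x ^ suc p)) (nCn≡1 (suc p)) ⟩
    1ℤ ℤ.+ + (1 * x ^ suc p)                              ≡⟨ cong (λ y → 1ℤ ℤ.+ + y) (*-identityˡ (x ^ suc p)) ⟩
    1ℤ ℤ.+ + (x ^ suc p)                                  ∎
    where
    open ≡[mod]-Reasoning
    B : ℕ → ℕ
    B = binomialPrefix x (suc p)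

  a^p≡a[mod] : ∀ {p} a → Prime p → + (a ^ p) ≡ + a [mod p ]
  a^p≡a[mod] {suc p} zero    prime-p = ≡[mod]-refl
  a^p≡a[mod] {p}     (suc a) prime-p = begin
    + ((1 + a) ^ p)         ≈⟨ freshmans-dream a prime-p ⟩
    1ℤ ℤ.+ + (a ^ p)        ≈⟨ +-cong[mod] (≡[mod]-refl {x = 1ℤ}) (a^p≡a[mod] a prime-p) ⟩
    1ℤ ℤ.+ + a              ≡⟨⟩
    + suc a                 ∎
    where open ≡[mod]-Reasoning

  fermat : ∀ {p a} → Prime p → ¬ (p ∣ a) → (+ a) ℤ.^ (p ∸ 1) ≡ 1ℤ [mod p ]
  fermat {suc p} {a} prime-p p∤a = *-cancel-prime-≡[mod] {u = + a} prime-p p∤a (begin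
    + a ℤ.* (+ a) ℤ.^ p    ≡⟨ pos-^ a (suc p) ⟨
    + (a ^ suc p)          ≈⟨ a^p≡a[mod] a prime-p ⟩
    + a                    ≡⟨ ℤ.*-identityʳ (+ a) ⟨
    + a ℤ.* 1ℤ             ∎)
    where open ≡[mod]-Reasoning

module RootBound where
  open import Data.Nat.Base as ℕ using (ℕ; zero; suc; s≤s; z≤n; nonTrivial⇒≢1)
  import Data.Nat.Properties as ℕ
  open import Data.Nat.Properties using (anyUpTo?)
  import Data.Nat.Divisibility as ℕ
  open import Data.Nat.Primality using (Prime; prime⇒nonTrivial; ¬prime[1])
  open import Data.Fin.Base using (Fin; toℕ)
  open import Data.Fin.Properties using (toℕ-injective; toℕ<n)
  open import Data.Integer.Base using (ℤ; +_; _+_; _*_; _-_; _^_; 0ℤ; 1ℤ; -1ℤ)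
  import Data.Integer.Properties as ℤ
  open import Data.Integer.Divisibility.Signed using (∣ᵤ⇒∣; ∣⇒∣ᵤ)
  open import Data.Integer.Tactic.RingSolver using (solve-∀)
  open import Data.List.Base using (List; []; _∷_; length; tabulate)
  open import Data.List.Properties using (length-tabulate)
  open import Data.List.Relation.Unary.All as All using (All; _∷_)
  import Data.List.Relation.Unary.All.Properties as All
  open import Data.List.Relation.Unary.AllPairs using (AllPairs; _∷_)
  import Data.List.Relation.Unary.AllPairs.Properties as AllPairs
  open import Data.Product
  open import Data.Empty using (⊥-elim)
  open import Relation.Nullary.Negation using (¬_)
  open import Relation.Nullary.Decidable using (Dec; yes; no; _×-dec_; ¬?; decidable-stable)
  open import Relation.Binary.PropositionalEquality
  open Congruence

  -- Horner form: f x = c₀ + x * (c₁ + x * (⋯ + x * lead)), with d nested factors of x.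
  Polynomial : ℕ → ℤ → (ℤ → ℤ) → Set
  Polynomial zero    lead f = ∀ x → f x ≡ lead
  Polynomial (suc d) lead f = ∃[ g ] Polynomial d lead g × ∃[ c ] ∀ x → f x ≡ c + x * g x

  polynomial-scale : ∀ {d lead f} r → Polynomial d lead f → Polynomial d (r * lead) (λ x → r * f x)
  polynomial-scale {zero}  r f≡lead x = cong (r *_) (f≡lead x)
  polynomial-scale {suc d} {f = f} r (g , g-poly , c , f≡) =
    (λ x → r * g x) , polynomial-scale r g-poly , r * c , λ x → trans (cong (r *_) (f≡ x)) (distrib r c x (g x))
    where distrib : ∀ r c x y → r * (c + x * y) ≡ r * c + x * (r * y)
          distrib = solve-∀

  polynomial-+-lower : ∀ {d lead lead′ f h} → Polynomial (suc d) lead f → Polynomial d lead′ h →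
                       Polynomial (suc d) lead (λ x → f x + h x)
  polynomial-+-lower {zero} {lead′ = lead′} (g , g-poly , c , f≡) h≡lead′ =
    g , g-poly , c + lead′ , λ x → trans (cong₂ _+_ (f≡ x) (h≡lead′ x)) (regroup c x (g x) lead′)
    where regroup : ∀ c x y l → c + x * y + l ≡ c + l + x * y
          regroup = solve-∀
  polynomial-+-lower {suc d} (g , g-poly , c , f≡) (k , k-poly , c′ , h≡) =
    (λ x → g x + k x) , polynomial-+-lower g-poly k-poly , c + c′ ,
    λ x → trans (cong₂ _+_ (f≡ x) (h≡ x)) (regroup c c′ x (g x) (k x))
    where regroup : ∀ c c′ x y z → c + x * y + (c′ + x * z) ≡ c + c′ + x * (y + z)
          regroup = solve-∀

  factor-theorem : ∀ {d lead f} → Polynomial (suc d) lead f → ∀ r →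
                   ∃[ g ] Polynomial d lead g × ∀ x → f x - f r ≡ (x - r) * g x
  factor-theorem {zero} {lead} {f} (g , g≡lead , c , f≡) r = g , g≡lead , λ x → begin
    f x - f r                    ≡⟨ cong₂ _-_ (f≡ x) (f≡ r) ⟩
    c + x * g x - (c + r * g r)  ≡⟨ cong₂ (λ u v → c + x * u - (c + r * v)) (g≡lead x) (g≡lead r) ⟩
    c + x * lead - (c + r * lead) ≡⟨ regroup c x r lead ⟩
    (x - r) * lead               ≡⟨ cong ((x - r) *_) (g≡lead x) ⟨
    (x - r) * g x                ∎
    where
    open ≡-Reasoning
    regroup : ∀ c x r l → c + x * l - (c + r * l) ≡ (x - r) * l
    regroup = solve-∀
  factor-theorem {suc d} {lead} {f} (g , g-poly , c , f≡) r with factor-theorem g-poly r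
  ... | q , q-poly , g-factored =
    (λ x → g x + r * q x) , polynomial-+-lower g-poly (polynomial-scale r q-poly) , λ x → begin
    f x - f r                          ≡⟨ cong₂ _-_ (f≡ x) (f≡ r) ⟩
    c + x * g x - (c + r * g r)        ≡⟨ regroup c x r (g x) (g r) ⟩
    (x - r) * g x + r * (g x - g r)    ≡⟨ cong (λ t → (x - r) * g x + r * t) (g-factored x) ⟩
    (x - r) * g x + r * ((x - r) * q x) ≡⟨ regroup′ x r (g x) (q x) ⟩
    (x - r) * (g x + r * q x)          ∎
    where
    open ≡-Reasoning
    regroup : ∀ c x r gx gr → c + x * gx - (c + r * gr) ≡ (x - r) * gx + r * (gx - gr)
    regroup = solve-∀
    regroup′ : ∀ x r gx qx → (x - r) * gx + r * ((x - r) * qx) ≡ (x - r) * (gx + r * qx)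
    regroup′ = solve-∀

  root-bound : ∀ {p d lead f} → Prime p → ¬ (lead ≡ 0ℤ [mod p ]) → Polynomial d lead f →
               (rs : List ℤ) → AllPairs (λ r s → ¬ (r ≡ s [mod p ])) rs → All (λ r → f r ≡ 0ℤ [mod p ]) rs →
               length rs ℕ.≤ d
  root-bound _ _ _ [] _ _ = z≤n
  root-bound {d = zero} _ lead≢0 f≡lead (r ∷ _) _ (fr≡0 ∷ _) =
    ⊥-elim (lead≢0 (≡[mod]-trans (≡⇒≡[mod] (sym (f≡lead r))) fr≡0))
  root-bound {p} {suc d} {f = f} prime-p lead≢0 f-poly (r ∷ rs) (r≢rs ∷ rs-distinct) (fr≡0 ∷ frs≡0)
    with factor-theorem f-poly r
  ... | g , g-poly , f-factored =
    s≤s (root-bound prime-p lead≢0 g-poly rs rs-distinct (All.zipWith g-root (r≢rs , frs≡0)))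
    where
    g-root : ∀ {s} → ¬ (r ≡ s [mod p ]) × f s ≡ 0ℤ [mod p ] → g s ≡ 0ℤ [mod p ]
    g-root {s} (r≢s , fs≡0) = *-cancel-prime-≡[mod] {u = s - r} prime-p
      (λ p∣s-r → r≢s (≡[mod]-sym (mod∣ (∣ᵤ⇒∣ p∣s-r))))
      (begin
        (s - r) * g s  ≡⟨ f-factored s ⟨
        f s - f r      ≈⟨ -cong[mod] fs≡0 fr≡0 ⟩
        0ℤ - 0ℤ        ≡⟨ ℤ.*-zeroʳ (s - r) ⟨
        (s - r) * 0ℤ   ∎)
      where open ≡[mod]-Reasoning

  x^[1+m]+c-polynomial : ∀ m c → Polynomial (suc m) 1ℤ (λ x → x ^ suc m + c)
  x^[1+m]+c-polynomial zero    c = (λ _ → 1ℤ) , (λ _ → refl) , c , λ x → ℤ.+-comm (x * 1ℤ) c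
  x^[1+m]+c-polynomial (suc m) c =
    (λ x → x ^ suc m + 0ℤ) , x^[1+m]+c-polynomial m 0ℤ , c , λ x → regroup x (x ^ suc m) c
    where regroup : ∀ x y c → x * y + c ≡ c + x * (y + 0ℤ)
          regroup = solve-∀

  -- The p - 1 pairwise incongruent residues 1, …, p - 1 cannot all be roots of x ^ h - 1, as h = (p - 1) / 2.
  exists-non-root : ∀ {p h} → Prime p → p ℕ.∸ 1 ≡ 2 ℕ.* h →
                    ∃[ b ] ¬ (p ℕ.∣ b) × ¬ ((+ b) ^ h ≡ 1ℤ [mod p ])
  exists-non-root {1}      {zero}  prime-1 _ = ⊥-elim (¬prime[1] prime-1)
  exists-non-root {suc p′} {suc h} prime-p p′≡2[1+h] with anyUpTo? non-root? (suc p′)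
    where
    non-root? : ∀ b → Dec (0 ℕ.< b × ¬ ((+ b) ^ suc h ≡ 1ℤ [mod suc p′ ]))
    non-root? b = 0 ℕ.<? b ×-dec ¬? ((+ b) ^ suc h ≡? 1ℤ [mod suc p′ ])
  ... | yes (b , b<p , 0<b , non-root) = b , (λ p∣b → ℕ.<⇒≱ b<p (ℕ.∣⇒≤ ⦃ ℕ.>-nonZero 0<b ⦄ p∣b)) , non-root
  ... | no none = ⊥-elim (ℕ.<⇒≱ 1+h<p′ (root-bound prime-p 1≢0 (x^[1+m]+c-polynomial h -1ℤ) residues
                                                  (AllPairs.tabulate⁺ incongruent) (All.tabulate⁺ root)))
    where
    residues : List ℤ
    residues = tabulate (λ (i : Fin p′) → + suc (toℕ i))
    1+h<p′ : suc h ℕ.< length residues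
    1+h<p′ rewrite length-tabulate (λ (i : Fin p′) → + suc (toℕ i)) | p′≡2[1+h] = ℕ.m<m+n (suc h) (s≤s z≤n)
    1≢0 : ¬ (1ℤ ≡ 0ℤ [mod suc p′ ])
    1≢0 (mod∣ p∣1) = nonTrivial⇒≢1 ⦃ prime⇒nonTrivial prime-p ⦄ (ℕ.∣1⇒≡1 (∣⇒∣ᵤ p∣1))
    incongruent : ∀ {i j : Fin p′} → i ≢ j → ¬ (+ suc (toℕ i) ≡ + suc (toℕ j) [mod suc p′ ])
    incongruent i≢j i≡j = i≢j (toℕ-injective (ℕ.suc-injective (≡[mod]⇒≡ (s≤s (toℕ<n _)) (s≤s (toℕ<n _)) i≡j)))
    root : ∀ (i : Fin p′) → (+ suc (toℕ i)) ^ suc h + -1ℤ ≡ 0ℤ [mod suc p′ ]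
    root i = +-cong[mod] (decidable-stable (_ ≡? _ [mod _ ])
                           λ non-root → none (suc (toℕ i) , s≤s (toℕ<n i) , s≤s z≤n , non-root))
                         (≡[mod]-refl {x = -1ℤ})

module SquareFree where
  open import Data.Nat.Base
  open import Data.Nat.Properties
  open import Data.Nat.Divisibility
  open import Data.Nat.Induction using (<-wellFounded)
  open import Data.Nat.Coprimality using (Coprime)
  open import Data.Nat.Primality using (Prime; prime⇒irreducible; prime⇒nonTrivial)
  open import Data.Nat.Primality.Factorisation using (factorise)
  open import Data.Nat.ListAction using (product)
  open import Data.List.Base using (_∷_)
  open import Data.List.Relation.Unary.All using (_∷_)
  open import Data.Product
  open import Data.Sum.Base using (inj₁; inj₂)
  open import Data.Empty using (⊥-elim)
  open import Induction.WellFounded using (Acc; acc)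
  open import Relation.Nullary.Negation using (¬_)
  open import Relation.Binary.PropositionalEquality
  open ChineseRemainder using (coprime⇒*∣)

  SquareFree : ℕ → Set
  SquareFree n = ∀ p → Prime p → ¬ (p * p ∣ n)

  prime-factor : ∀ n → 2 ≤ n → ∃[ p ] Prime p × p ∣ n
  prime-factor 1                (s≤s ())
  prime-factor n@(suc (suc _)) _ with factorise n
  ... | record { factors = p ∷ ps ; isFactorisation = n≡p*ps ; factorsPrime = prime-p ∷ _ } =
    p , prime-p , divides (product ps) (trans n≡p*ps (*-comm p (product ps)))

  squarefree-∣ : ∀ {m n} → m ∣ n → SquareFree n → SquareFree m
  squarefree-∣ m∣n sf p prime-p p²∣m = sf p prime-p (∣-trans p²∣m m∣n)

  squarefree⇒coprime-cofactor : ∀ {n m p} → SquareFree n → Prime p → n ≡ m * p → Coprime p m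
  squarefree⇒coprime-cofactor {m = m} sf prime-p refl {i} (i∣p , i∣m) with prime⇒irreducible prime-p i∣p
  ... | inj₁ i≡1 = i≡1
  ... | inj₂ refl = ⊥-elim (sf i prime-p (*-monoˡ-∣ i i∣m))

  squarefree⇒∣ : ∀ {x} n → 0 < n → SquareFree n → (∀ p → Prime p → p ∣ n → p ∣ x) → n ∣ x
  squarefree⇒∣ {x} n = go n (<-wellFounded n)
    where
    go : ∀ n → Acc _<_ n → 0 < n → SquareFree n → (∀ p → Prime p → p ∣ n → p ∣ x) → n ∣ x
    go 1                   _         _ _  _       = 1∣ x
    go 0                   _         () _ _
    go n@(suc (suc _)) (acc smaller) _ sf primes∣x with prime-factor n (s≤s (s≤s z≤n))
    ... | p , prime-p , divides m n≡m*p =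
      subst (_∣ x) (trans (*-comm p m) (sym n≡m*p))
            (coprime⇒*∣ (squarefree⇒coprime-cofactor sf prime-p n≡m*p) (primes∣x p prime-p (divides m n≡m*p)) m∣x)
      where
      m∣n : m ∣ n
      m∣n = divides p (trans n≡m*p (*-comm m p))
      0<m : 0 < m
      0<m = n≢0⇒n>0 λ { refl → 1+n≢0 n≡m*p }
      m<n : m < n
      m<n = subst (m <_) (sym n≡m*p) (m<m*n m p ⦃ >-nonZero 0<m ⦄ (nonTrivial⇒n>1 p ⦃ prime⇒nonTrivial prime-p ⦄))
      m∣x : m ∣ x
      m∣x = go m (smaller m<n) 0<m (squarefree-∣ m∣n sf) (λ q prime-q q∣m → primes∣x q prime-q (∣-trans q∣m m∣n))

module CarmichaelNumbers where
  open import Data.Nat.Base as ℕ using (ℕ; zero; suc; s≤s; z≤n; NonTrivial; nonTrivial⇒≢1; _<_; _≤_)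
  import Data.Nat.Properties as ℕ
  open import Data.Nat.Divisibility as ℕ using (_∣_; divides; _∣?_; ∣1⇒≡1; ∣⇒≤; ∣m+n∣m⇒∣n; ∣n⇒∣m*n; ∣-trans)
  open import Data.Nat.Primality using (composite; prime⇒nonTrivial; prime⇒nonZero)
  open import Data.Nat.Tactic.RingSolver renaming (solve-∀ to ℕ-solve-∀)
  open import Data.Nat.Coprimality using (Coprime)
  open import Data.Integer.Base using (+_; _+_; _*_; _^_; 0ℤ; 1ℤ; -1ℤ)
  import Data.Integer.Properties as ℤ
  open import Data.Integer.Divisibility.Signed using (∣⇒∣ᵤ)
  import Data.Integer.Divisibility.Signed as ℤ
  open import Data.Integer.Tactic.RingSolver using (solve-∀)
  open import Data.Product
  open import Data.Empty using (⊥-elim)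
  open import Relation.Nullary.Negation using (¬_)
  open import Relation.Nullary.Decidable using (yes; no)
  open import Relation.Binary.PropositionalEquality
  open import Defs using (Carmichael; Odd)
  open Congruence
  open TwoAdic using (odd⇒≡1+2k)
  open CarmichaelFunction using (Annihilates; annihilates⇒≡1[mod])
  open SquareFree using (SquareFree)

  carmichael⇒3≤ : ∀ {n} → Carmichael n → 3 ≤ n
  carmichael⇒3≤ {n} (composite {d} d<n _ , _) = lemma d d<n
    where lemma : ∀ d → .{{NonTrivial d}} → d < n → 3 ≤ n
          lemma (suc (suc d)) d<n = ℕ.≤-trans (s≤s (s≤s (s≤s z≤n))) d<n

  carmichael⇒0< : ∀ {n} → Carmichael n → 0 < n
  carmichael⇒0< C = ℕ.≤-trans (s≤s z≤n) (carmichael⇒3≤ C)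

  private
    n∸1+1≡n : ∀ {n} → 1 ≤ n → n ℕ.∸ 1 ℕ.+ 1 ≡ n
    n∸1+1≡n {suc n} _ = ℕ.+-comm n 1

  -- For n ≥ 3 the unit n - 1 ≡ -1 has order exactly 2.
  annihilates⇒even : ∀ {n m} → 3 ≤ n → Annihilates n m → 2 ∣ m
  annihilates⇒even {n} {m} 3≤n ann with 2 ∣? m
  ... | yes 2∣m = 2∣m
  ... | no  odd-m with odd⇒≡1+2k odd-m
  ... | k , refl = ⊥-elim (ℕ.<⇒≱ 3≤n (∣⇒≤ (∣⇒∣ᵤ (modulus∣difference -1≡1))))
    where
    1≤n : 1 ≤ n
    1≤n = ℕ.≤-trans (s≤s z≤n) 3≤n
    n∸1⊥n : Coprime (n ℕ.∸ 1) n
    n∸1⊥n (i∣n∸1 , i∣n) = ∣1⇒≡1 (∣m+n∣m⇒∣n (subst (_ ∣_) (sym (n∸1+1≡n 1≤n)) i∣n) i∣n∸1)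
    n∸1≡-1 : + (n ℕ.∸ 1) ≡ -1ℤ [mod n ]
    n∸1≡-1 = mod∣ (ℤ.divides 1ℤ (trans (ℤ.+-comm (+ (n ℕ.∸ 1)) 1ℤ)
                   (trans (cong +_ (trans (ℕ.+-comm 1 _) (n∸1+1≡n 1≤n))) (sym (ℤ.*-identityˡ (+ n))))))
    -1^[2k]≡1 : -1ℤ ^ (k ℕ.* 2) ≡ 1ℤ
    -1^[2k]≡1 = trans (cong (-1ℤ ^_) (ℕ.*-comm k 2)) (trans (sym (ℤ.^-*-assoc -1ℤ 2 k)) (ℤ.^-zeroˡ k))
    -1≡1 : -1ℤ ≡ 1ℤ [mod n ]
    -1≡1 = begin
      -1ℤ                               ≡⟨ cong (-1ℤ *_) -1^[2k]≡1 ⟨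
      -1ℤ ^ suc (k ℕ.* 2)               ≈⟨ ^-cong[mod] (suc (k ℕ.* 2)) n∸1≡-1 ⟨
      (+ (n ℕ.∸ 1)) ^ suc (k ℕ.* 2)     ≈⟨ annihilates⇒≡1[mod] (suc (k ℕ.* 2)) ann n∸1⊥n ⟩
      1ℤ                                ∎
      where open ≡[mod]-Reasoning

  carmichael⇒odd : ∀ {n} → Carmichael n → Odd n
  carmichael⇒odd {n} C@(_ , ann) 2∣n =
    2∤1 (∣m+n∣m⇒∣n (subst (2 ∣_) (sym (n∸1+1≡n (carmichael⇒0< C))) 2∣n)
                   (annihilates⇒even {m = n ℕ.∸ 1} (carmichael⇒3≤ C) ann))
    where 2∤1 : ¬ (2 ∣ 1)
          2∤1 2∣1 with ∣1⇒≡1 2∣1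
          ... | ()

  nilpotent-binomial : ∀ {n T} k → T * T ≡ 0ℤ [mod n ] → (1ℤ + T) ^ k ≡ 1ℤ + + k * T [mod n ]
  nilpotent-binomial {n} {T} zero    _      =
    ≡⇒≡[mod] (trans (sym (ℤ.+-identityʳ 1ℤ)) (cong (λ t → 1ℤ + t) (sym (ℤ.*-zeroˡ T))))
  nilpotent-binomial {n} {T} (suc k) T²≡0 = begin
    (1ℤ + T) * (1ℤ + T) ^ k                  ≈⟨ *-cong[mod] (≡[mod]-refl {x = 1ℤ + T}) (nilpotent-binomial k T²≡0) ⟩
    (1ℤ + T) * (1ℤ + + k * T)                ≡⟨ expand T (+ k) ⟩
    1ℤ + (1ℤ + + k) * T + + k * (T * T)
      ≈⟨ +-cong[mod] (≡[mod]-refl {x = 1ℤ + (1ℤ + + k) * T}) (*-cong[mod] (≡[mod]-refl {x = + k}) T²≡0) ⟩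
    1ℤ + (1ℤ + + k) * T + + k * 0ℤ
      ≡⟨ trans (cong (λ t → 1ℤ + (1ℤ + + k) * T + t) (ℤ.*-zeroʳ (+ k))) (ℤ.+-identityʳ _) ⟩
    1ℤ + (1ℤ + + k) * T                      ≡⟨⟩
    1ℤ + + suc k * T                         ∎
    where
    open ≡[mod]-Reasoning
    expand : ∀ T K → (1ℤ + T) * (1ℤ + K * T) ≡ 1ℤ + (1ℤ + K) * T + K * (T * T)
    expand = solve-∀

  -- With t = p m, where n = m p², t² = m n ≡ 0, so 1 + t is a unit and (1 + t) ^ (n - 1) ≡ 1 + (n - 1) t.
  -- The Carmichael property then forces n ∣ (n - 1) t, i.e. p ∣ n - 1, contradicting p ∣ n.
  carmichael⇒squarefree : ∀ {n} → Carmichael n → SquareFree n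
  carmichael⇒squarefree {n} C@(_ , ann) p prime-p (divides m n≡m*p²) =
    nonTrivial⇒≢1 ⦃ prime⇒nonTrivial prime-p ⦄ (∣1⇒≡1 p∣1)
    where
    t : ℕ
    t = p ℕ.* m
    1≤n : 1 ≤ n
    1≤n = carmichael⇒0< C
    t*t≡m*n : t ℕ.* t ≡ m ℕ.* n
    t*t≡m*n = trans (regroup p m) (cong (m ℕ.*_) (sym n≡m*p²))
      where regroup : ∀ p m → p ℕ.* m ℕ.* (p ℕ.* m) ≡ m ℕ.* (m ℕ.* (p ℕ.* p))
            regroup = ℕ-solve-∀
    n∣t*t : n ∣ t ℕ.* t
    n∣t*t = divides m t*t≡m*n
    1+t⊥n : Coprime (1 ℕ.+ t) n
    1+t⊥n {i} (i∣1+t , i∣n) = ∣1⇒≡1 (∣m+n∣m⇒∣n (subst (i ∣_) (ℕ.+-comm 1 t) i∣1+t) i∣t)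
      where
      i∣t : i ∣ t
      i∣t = ∣m+n∣m⇒∣n (subst (i ∣_) (trans (ℕ.*-suc t t) (ℕ.+-comm t (t ℕ.* t))) (∣n⇒∣m*n t i∣1+t))
                      (∣-trans i∣n n∣t*t)
    n∣[n∸1]*t : n ∣ (n ℕ.∸ 1) ℕ.* t
    n∣[n∸1]*t = ≡[mod]⇒∣∸ (begin
      + (1 ℕ.+ (n ℕ.∸ 1) ℕ.* t)   ≡⟨ cong (λ x → 1ℤ + x) (ℤ.pos-* (n ℕ.∸ 1) t) ⟩
      1ℤ + + (n ℕ.∸ 1) * + t      ≈⟨ nilpotent-binomial (n ℕ.∸ 1) t²≡0 ⟨
      (1ℤ + + t) ^ (n ℕ.∸ 1)      ≈⟨ annihilates⇒≡1[mod] (n ℕ.∸ 1) ann 1+t⊥n ⟩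
      1ℤ                          ∎) (s≤s z≤n)
      where
      open ≡[mod]-Reasoning
      t²≡0 : + t * + t ≡ 0ℤ [mod n ]
      t²≡0 = subst (_≡ 0ℤ [mod n ]) (ℤ.pos-* t t) (∣⇒≡0[mod] n∣t*t)
    instance
      t≢0 : ℕ.NonZero t
      t≢0 = ℕ.m*n≢0 p m ⦃ prime⇒nonZero prime-p ⦄
                        ⦃ ℕ.≢-nonZero (λ { refl → ℕ.<⇒≱ 1≤n (ℕ.≤-reflexive n≡m*p²) }) ⦄
    p∣n∸1 : p ∣ n ℕ.∸ 1
    p∣n∸1 = ℕ.*-cancelʳ-∣ t (subst (_∣ (n ℕ.∸ 1) ℕ.* t) (trans n≡m*p² (regroup m p)) n∣[n∸1]*t)
      where regroup : ∀ m p → m ℕ.* (p ℕ.* p) ≡ p ℕ.* (p ℕ.* m)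
            regroup = ℕ-solve-∀
    p∣1 : p ∣ 1
    p∣1 = ∣m+n∣m⇒∣n (subst (p ∣_) (sym (n∸1+1≡n 1≤n))
                                    (divides (m ℕ.* p) (trans n≡m*p² (sym (ℕ.*-assoc m p p)))))
                    p∣n∸1

module PrimeFactors where
  open import Data.Nat.Base
  open import Data.Nat.Properties
  open import Data.Nat.Divisibility
  open import Data.Nat.Coprimality using (Coprime)
  open import Data.Nat.GCD using (gcd; gcd-comm)
  open import Data.Nat.Primality using (Prime; prime?; prime⇒irreducible; prime⇒nonTrivial)
  open import Data.Integer.Base as ℤ using (+_; 1ℤ)
  open import Data.Product
  open import Data.Sum.Base using (inj₁; inj₂)
  open import Data.Empty using (⊥; ⊥-elim)
  open import Relation.Nullary.Negation using (¬_)
  open import Relation.Nullary.Decidable using (yes; no; _×-dec_)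
  open import Relation.Binary.PropositionalEquality
  open import Defs using (Carmichael; IsLambda; v2)
  open Congruence
  open TwoAdic using (gcd-∣-half)
  open UnitPowers using (^-∣-≡1[mod]; ^-gcd-≡1[mod]; ≡1[mod]⇒CongOne)
  open ChineseRemainder using (crt-lift)
  open CarmichaelFunction using (Annihilates; annihilates⇒≡1[mod])
  open Fermat using (fermat)
  open RootBound using (exists-non-root)
  open SquareFree
  open CarmichaelNumbers

  private
    0<p∸1 : ∀ {p} → Prime p → 0 < p ∸ 1
    0<p∸1 prime-p with nonTrivial⇒n>1 _ ⦃ prime⇒nonTrivial prime-p ⦄
    ... | s≤s (s≤s z≤n) = s≤s z≤n

    p∤⇒coprime : ∀ {p b} → Prime p → ¬ (p ∣ b) → Coprime b p
    p∤⇒coprime prime-p p∤b {i} (i∣b , i∣p) with prime⇒irreducible prime-p i∣p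
    ... | inj₁ i≡1 = i≡1
    ... | inj₂ refl = ⊥-elim (p∤b i∣b)

  ^-gcd[λ,p∸1]≡1[mod] : ∀ {n ℓ p a} → IsLambda n ℓ → Prime p → p ∣ n → Coprime a n →
                        (+ a) ℤ.^ gcd ℓ (p ∸ 1) ≡ 1ℤ [mod p ]
  ^-gcd[λ,p∸1]≡1[mod] {ℓ = ℓ} {p} (_ , ann , _) prime-p p∣n a⊥n =
    ^-gcd-≡1[mod] ℓ (p ∸ 1) (≡[mod]-∣ p∣n (annihilates⇒≡1[mod] ℓ ann a⊥n))
                            (fermat prime-p λ p∣a → nonTrivial⇒≢1 ⦃ prime⇒nonTrivial prime-p ⦄ (a⊥n (p∣a , p∣n)))

  -- Otherwise gcd (λ, p - 1) divides (p - 1) / 2, so every unit mod p would be a root of x ^ ((p-1)/2) - 1.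
  v2[p∸1]≤v2[λ] : ∀ {n ℓ p} → Carmichael n → IsLambda n ℓ → Prime p → p ∣ n → v2 (p ∸ 1) ≤ v2 ℓ
  v2[p∸1]≤v2[λ] {n} {ℓ} {p} C λ-n@(0<ℓ , _) prime-p p∣n@(divides m n≡m*p) with v2 (p ∸ 1) ≤? v2 ℓ
  ... | yes ≤ = ≤
  ... | no  ≰ with gcd-∣-half 0<ℓ (0<p∸1 prime-p) (≰⇒> ≰)
  ... | h , p∸1≡2h , gcd∣h with exists-non-root {h = h} prime-p p∸1≡2h
  ... | b , p∤b , b^h≢1 = ⊥-elim (no-lift (crt-lift p⊥m (p∤⇒coprime prime-p p∤b)))
    where
    p⊥m : Coprime p m
    p⊥m = squarefree⇒coprime-cofactor (carmichael⇒squarefree C) prime-p n≡m*p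
    no-lift : ∃[ a ] Coprime a (p * m) × + a ≡ + b [mod p ] → ⊥
    no-lift (a , a⊥pm , a≡b) = b^h≢1 (begin
      (+ b) ℤ.^ h  ≈⟨ ^-cong[mod] h a≡b ⟨
      (+ a) ℤ.^ h  ≈⟨ ^-∣-≡1[mod] gcd∣h (^-gcd[λ,p∸1]≡1[mod] λ-n prime-p p∣n a⊥n) ⟩
      1ℤ           ∎)
      where
      open ≡[mod]-Reasoning
      a⊥n : Coprime a n
      a⊥n = subst (Coprime a) (trans (*-comm p m) (sym n≡m*p)) a⊥pm

  -- Otherwise ℓ / 2 would annihilate the units modulo every prime factor, hence modulo the squarefree n.
  ∃prime-v2[p∸1]≡v2[λ] : ∀ {n ℓ} → Carmichael n → IsLambda n ℓ → ∃[ p ] Prime p × p ∣ n × v2 (p ∸ 1) ≡ v2 ℓ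
  ∃prime-v2[p∸1]≡v2[λ] {n} {ℓ} C λ-n with anyUpTo? (λ q → prime? q ×-dec q ∣? n ×-dec v2 ℓ ≤? v2 (q ∸ 1)) (suc n)
  ... | yes (p , _ , prime-p , p∣n , v2ℓ≤) = p , prime-p , p∣n , ≤-antisym (v2[p∸1]≤v2[λ] C λ-n prime-p p∣n) v2ℓ≤
  ... | no  none = ⊥-elim (half-annihilates (annihilates⇒even (carmichael⇒3≤ C) (proj₁ (proj₂ λ-n))))
    where
    0<n : 0 < n
    0<n = carmichael⇒0< C
    v2[p∸1]<v2[λ] : ∀ {p} → Prime p → p ∣ n → v2 (p ∸ 1) < v2 ℓ
    v2[p∸1]<v2[λ] prime-p p∣n = ≰⇒> λ v2ℓ≤ → none (_ , s≤s (∣⇒≤ ⦃ >-nonZero 0<n ⦄ p∣n) , prime-p , p∣n , v2ℓ≤)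
    half-annihilates : 2 ∣ ℓ → ⊥
    half-annihilates (divides ℓ/2 ℓ≡ℓ/2*2) = <⇒≱ ℓ/2<ℓ (minimal ℓ/2 0<ℓ/2 annihilates-ℓ/2)
      where
      0<ℓ : 0 < ℓ
      0<ℓ = proj₁ λ-n
      minimal : ∀ m → 0 < m → Annihilates n m → ℓ ≤ m
      minimal = proj₂ (proj₂ λ-n)
      0<ℓ/2 : 0 < ℓ/2
      0<ℓ/2 = n≢0⇒n>0 λ { refl → >⇒≢ 0<ℓ ℓ≡ℓ/2*2 }
      ℓ/2<ℓ : ℓ/2 < ℓ
      ℓ/2<ℓ = subst (ℓ/2 <_) (sym ℓ≡ℓ/2*2) (m<m*n ℓ/2 2 ⦃ >-nonZero 0<ℓ/2 ⦄ (s≤s (s≤s z≤n)))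
      annihilates-ℓ/2 : Annihilates n ℓ/2
      annihilates-ℓ/2 a a⊥n = squarefree⇒∣ n 0<n (carmichael⇒squarefree C) λ p prime-p p∣n →
        ≡1[mod]⇒CongOne a ℓ/2 (mod-p p prime-p p∣n)
        where
        mod-p : ∀ p → Prime p → p ∣ n → (+ a) ℤ.^ ℓ/2 ≡ 1ℤ [mod p ]
        mod-p p prime-p p∣n with gcd-∣-half (0<p∸1 prime-p) 0<ℓ (v2[p∸1]<v2[λ] prime-p p∣n)
        ... | h , ℓ≡2h , gcd∣h = ^-∣-≡1[mod] (subst₂ _∣_ (gcd-comm (p ∸ 1) ℓ) h≡ℓ/2 gcd∣h)
                                              (^-gcd[λ,p∸1]≡1[mod] λ-n prime-p p∣n a⊥n)
          where h≡ℓ/2 : h ≡ ℓ/2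
                h≡ℓ/2 = *-cancelˡ-≡ h ℓ/2 2 (trans (sym ℓ≡2h) (trans ℓ≡ℓ/2*2 (*-comm ℓ/2 2)))

module PrimeFactorCounts where
  open import Data.Nat.Base
  open import Data.Nat.Properties using (m≤n⇒m≤1+n; _≟_)
  open import Data.Nat.Divisibility using (_∣_; _∣?_; ∣⇒≤)
  open import Data.Nat.Primality using (Prime; prime?)
  open import Data.List.Base using (_∷_; length; filter; upTo)
  open import Data.List.Properties using (filter-some)
  open import Data.List.Relation.Unary.Any using (here; there)
  open import Data.List.Membership.Propositional using (_∈_; lose)
  open import Data.List.Membership.Propositional.Properties using (∈-upTo⁺)
  import Data.List.Relation.Binary.Sublist.Propositional as Sublist
  import Data.List.Relation.Binary.Sublist.Propositional.Properties as Sublist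
  open import Data.Product
  open import Data.Empty using (⊥-elim)
  open import Level using (0ℓ)
  open import Relation.Nullary.Negation using (¬_)
  open import Relation.Nullary.Decidable using (yes; no; _×-dec_)
  open import Relation.Unary using (Pred; Decidable)
  open import Relation.Binary.PropositionalEquality
  open import Defs using (v2; hCount; numPrimeFactors)

  module _ {P Q : Pred ℕ 0ℓ} (P? : Decidable P) (Q? : Decidable Q) (P⇒Q : ∀ {x} → P x → Q x) where

    length-filter-mono : ∀ xs → length (filter P? xs) ≤ length (filter Q? xs)
    length-filter-mono xs = Sublist.length-mono-≤ (Sublist.filter⁺ P? Q? (λ { refl → P⇒Q }) (Sublist.⊆-refl {x = xs}))

    length-filter-mono-< : ∀ {y} xs → y ∈ xs → Q y → ¬ P y → length (filter P? xs) < length (filter Q? xs)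
    length-filter-mono-< (x ∷ xs) (here refl) Qx ¬Px with P? x | Q? x
    ... | yes Px | _      = ⊥-elim (¬Px Px)
    ... | no _   | yes _  = s≤s (length-filter-mono xs)
    ... | no _   | no ¬Qx = ⊥-elim (¬Qx Qx)
    length-filter-mono-< (x ∷ xs) (there y∈xs) Qy ¬Py with P? x | Q? x
    ... | yes Px | yes _  = s≤s (length-filter-mono-< xs y∈xs Qy ¬Py)
    ... | yes Px | no ¬Qx = ⊥-elim (¬Qx (P⇒Q Px))
    ... | no _   | yes _  = m≤n⇒m≤1+n (length-filter-mono-< xs y∈xs Qy ¬Py)
    ... | no _   | no _   = length-filter-mono-< xs y∈xs Qy ¬Py

  private
    isPrimeFactor? : ∀ n → Decidable (λ p → Prime p × p ∣ n)
    isPrimeFactor? n p = prime? p ×-dec p ∣? n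

    isHPrime? : ∀ n ℓ → Decidable (λ p → Prime p × p ∣ n × v2 (p ∸ 1) ≡ v2 ℓ)
    isHPrime? n ℓ p = prime? p ×-dec p ∣? n ×-dec v2 (p ∸ 1) ≟ v2 ℓ

    prime-factor∈ : ∀ {p n} → 0 < n → p ∣ n → p ∈ upTo (suc n)
    prime-factor∈ 0<n p∣n = ∈-upTo⁺ (s≤s (∣⇒≤ ⦃ >-nonZero 0<n ⦄ p∣n))

  1≤hCount : ∀ {n ℓ p} → 0 < n → Prime p → p ∣ n → v2 (p ∸ 1) ≡ v2 ℓ → 1 ≤ hCount n ℓ
  1≤hCount {n} {ℓ} 0<n prime-p p∣n v2≡ = filter-some (isHPrime? n ℓ) (lose (prime-factor∈ 0<n p∣n) (prime-p , p∣n , v2≡))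

  hCount<numPrimeFactors : ∀ {n ℓ p} → 0 < n → Prime p → p ∣ n → v2 (p ∸ 1) ≢ v2 ℓ → hCount n ℓ < numPrimeFactors n
  hCount<numPrimeFactors {n} {ℓ} 0<n prime-p p∣n v2≢ =
    length-filter-mono-< (isHPrime? n ℓ) (isPrimeFactor? n) (λ (prime-p , p∣n , _) → prime-p , p∣n)
                         (upTo (suc n)) (prime-factor∈ 0<n p∣n) (prime-p , p∣n) (λ (_ , _ , v2≡) → v2≢ v2≡)

  hCount≤numPrimeFactors : ∀ n ℓ → hCount n ℓ ≤ numPrimeFactors n
  hCount≤numPrimeFactors n ℓ =
    length-filter-mono (isHPrime? n ℓ) (isPrimeFactor? n) (λ (prime-p , p∣n , _) → prime-p , p∣n) (upTo (suc n))

module IndexParity where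
  open import Data.Nat.Base
  open import Data.Nat.Properties
  open import Data.Nat.Divisibility
  open import Data.Nat.Primality using (Prime)
  open import Data.Product
  open import Data.Sum.Base using (_⊎_; inj₁; inj₂)
  open import Data.Empty using (⊥-elim)
  open import Relation.Nullary.Decidable using (yes; no)
  open import Relation.Binary.PropositionalEquality
  open import Defs
  open TwoAdic
  open CarmichaelFunction using (λ-unique)
  open CarmichaelNumbers using (carmichael⇒0<)
  open PrimeFactors using (∃prime-v2[p∸1]≡v2[λ])
  open PrimeFactorCounts

  even-index : ∀ {ℓ ι} → 0 < ℓ → Even ι → 2 ^ suc (v2 ℓ) ∣ ι * ℓ
  even-index 0<ℓ 2∣ι = *-pres-∣ 2∣ι (power∣ (v2-∥ 0<ℓ))

  odd-index : ∀ {ℓ ι} → 0 < ℓ → Odd ι → 2^ v2 ℓ ∥ ι * ℓ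
  odd-index 0<ℓ odd-ι = ∥-*-odd (v2-∥ 0<ℓ) odd-ι

  classA⇒v2[λ]< : ∀ {m ℓ a} → IsLambda m ℓ → ClassA m → 2^ a ∥ m ∸ 1 → v2 ℓ < a
  classA⇒v2[λ]< λ-m@(0<ℓ , _) (ι , (ℓ′ , λ′-m , m∸1≡ιℓ′) , even-ι) a∥ with λ-unique λ′-m λ-m
  ... | refl = ∥-maximal a∥ (subst (2 ^ suc (v2 ℓ′) ∣_) (sym m∸1≡ιℓ′) (even-index 0<ℓ even-ι))

  classB⇒v2[λ]≡ : ∀ {m ℓ a} → IsLambda m ℓ → ClassB m → 2^ a ∥ m ∸ 1 → v2 ℓ ≡ a
  classB⇒v2[λ]≡ λ-m@(0<ℓ , _) (ι , (ℓ′ , λ′-m , m∸1≡ιℓ′) , odd-ι) a∥ with λ-unique λ′-m λ-m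
  ... | refl = ∥-unique (subst (2^ v2 ℓ′ ∥_) (sym m∸1≡ιℓ′) (odd-index 0<ℓ odd-ι)) a∥

  classA-intro : ∀ {m ℓ} → IsLambda m ℓ → ℓ ∣ m ∸ 1 → 2 ^ suc (v2 ℓ) ∣ m ∸ 1 → ClassA m
  classA-intro {ℓ = ℓ} λ-m@(0<ℓ , _) (divides ι m∸1≡ιℓ) 2^[1+v]∣ with 2 ∣? ι
  ... | yes even-ι = ι , (_ , λ-m , m∸1≡ιℓ) , even-ι
  ... | no  odd-ι  = ⊥-elim (next∤ (odd-index {ℓ} 0<ℓ odd-ι) (subst (2 ^ suc (v2 ℓ) ∣_) m∸1≡ιℓ 2^[1+v]∣))

  classB-intro : ∀ {m ℓ} → IsLambda m ℓ → ℓ ∣ m ∸ 1 → 2^ v2 ℓ ∥ m ∸ 1 → ClassB m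
  classB-intro {ℓ = ℓ} λ-m@(0<ℓ , _) (divides ι m∸1≡ιℓ) v∥ with 2 ∣? ι
  ... | no  odd-ι  = ι , (_ , λ-m , m∸1≡ιℓ) , odd-ι
  ... | yes even-ι = ⊥-elim (next∤ v∥ (subst (2 ^ suc (v2 ℓ) ∣_) (sym m∸1≡ιℓ) (even-index {ℓ} 0<ℓ even-ι)))

  classB1-intro : ∀ {n ℓ q} → Carmichael n → IsLambda n ℓ → ClassB n →
                  Prime q → q ∣ n → v2 (q ∸ 1) ≢ v2 ℓ → ClassB1 n
  classB1-intro {ℓ = ℓ} C λ-n classB prime-q q∣n v2≢ with ∃prime-v2[p∸1]≡v2[λ] C λ-n
  ... | p , prime-p , p∣n , v2≡ =
    classB , ℓ , λ-n , 1≤hCount {ℓ = ℓ} (carmichael⇒0< C) prime-p p∣n v2≡ ,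
    hCount<numPrimeFactors {ℓ = ℓ} (carmichael⇒0< C) prime-q q∣n v2≢

  classB1⊎B2-intro : ∀ {n ℓ} → Carmichael n → IsLambda n ℓ → ClassB n → ClassB1 n ⊎ ClassB2 n
  classB1⊎B2-intro {n} {ℓ} C λ-n classB
    with ∃prime-v2[p∸1]≡v2[λ] C λ-n | m≤n⇒m<n∨m≡n (hCount≤numPrimeFactors n ℓ)
  ... | p , prime-p , p∣n , v2≡ | inj₁ h<k =
    inj₁ (classB , ℓ , λ-n , 1≤hCount {ℓ = ℓ} (carmichael⇒0< C) prime-p p∣n v2≡ , h<k)
  ... | _                       | inj₂ h≡k = inj₂ (classB , ℓ , λ-n , h≡k)

open import Defs
open import Data.Nat using (ℕ; _*_; _∸_; _<_; _⊔_; _⊓_)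
open import Data.Nat.Coprimality using (Coprime)
open import Data.Product using (_×_; _,_)
open import Data.Sum using (_⊎_)
open import Relation.Nullary using (¬_)
open import Relation.Binary.PropositionalEquality using (_≡_; _≢_)

module CoprimeProduct
  {n₁ n₂ ℓ₁ ℓ₂ : ℕ} (C₁ : Carmichael n₁) (C₂ : Carmichael n₂) (n₁⊥n₂ : Coprime n₁ n₂)
  (λ₁ : IsLambda n₁ ℓ₁) (λ₂ : IsLambda n₂ ℓ₂) where
  open import Data.Nat.Base
  open import Data.Nat.Properties
  open import Data.Nat.Divisibility
  open import Data.Nat.LCM using (lcm)
  open import Data.Product
  open import Data.Sum.Base using (_⊎_)
  open import Data.Empty using (⊥-elim)
  open import Relation.Nullary.Negation using (¬_)
  open import Relation.Binary.Definitions using (tri<; tri≈; tri>)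
  open import Relation.Binary.PropositionalEquality
  open import Defs
  open TwoAdic
  open CarmichaelFunction using (λ-*; λ∣n∸1)
  open CarmichaelNumbers using (carmichael⇒3≤; carmichael⇒0<; carmichael⇒odd)
  open PrimeFactors using (∃prime-v2[p∸1]≡v2[λ])
  open IndexParity

  private
    n N a₁ a₂ e₁ e₂ E : ℕ
    n = n₁ * n₂
    N = n ∸ 1
    a₁ = v2 (n₁ ∸ 1)
    a₂ = v2 (n₂ ∸ 1)
    e₁ = v2 ℓ₁
    e₂ = v2 ℓ₂
    E = e₁ ⊔ e₂

    λ-n : IsLambda n (lcm ℓ₁ ℓ₂)
    λ-n = λ-* n₁⊥n₂ λ₁ λ₂

    v2[λ]≡E : v2 (lcm ℓ₁ ℓ₂) ≡ E
    v2[λ]≡E = ∥-unique (v2-∥ (proj₁ λ-n)) (∥-lcm (v2-∥ (proj₁ λ₁)) (v2-∥ (proj₁ λ₂)))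

    0<n₁ : 0 < n₁
    0<n₁ = carmichael⇒0< C₁
    0<n₂ : 0 < n₂
    0<n₂ = carmichael⇒0< C₂

    a₁∥ : 2^ a₁ ∥ n₁ ∸ 1
    a₁∥ = v2-∥ (m<n⇒0<n∸m (≤-trans (s≤s (s≤s z≤n)) (carmichael⇒3≤ C₁)))
    a₂∥ : 2^ a₂ ∥ n₂ ∸ 1
    a₂∥ = v2-∥ (m<n⇒0<n∸m (≤-trans (s≤s (s≤s z≤n)) (carmichael⇒3≤ C₂)))

    N-∥-< : a₁ < a₂ → 2^ a₁ ∥ N
    N-∥-< = ∥-*∸1-< 0<n₁ 0<n₂ a₁∥ a₂∥
    N-∥-> : a₂ < a₁ → 2^ a₂ ∥ N
    N-∥-> = ∥-*∸1-> 0<n₁ 0<n₂ a₁∥ a₂∥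
    N-∣-≡ : a₁ ≡ a₂ → 2 ^ suc a₁ ∣ N
    N-∣-≡ a₁≡a₂ = ∥-*∸1-≡ 0<n₁ 0<n₂ (carmichael⇒odd C₁) a₁∥ (subst (2^_∥ n₂ ∸ 1) (sym a₁≡a₂) a₂∥)

    E≤ : Carmichael n → ∀ {b} → 2^ b ∥ N → E ≤ b
    E≤ C b∥ =
      ∥-maximal b∥ (∣-trans (subst (λ e → 2 ^ e ∣ lcm ℓ₁ ℓ₂) v2[λ]≡E (power∣ (v2-∥ (proj₁ λ-n)))) (λ∣n∸1 C λ-n))

    classA-n : Carmichael n → 2 ^ suc E ∣ N → ClassA n
    classA-n C 2^[1+E]∣ =
      classA-intro λ-n (λ∣n∸1 C λ-n) (subst (λ e → 2 ^ suc e ∣ N) (sym v2[λ]≡E) 2^[1+E]∣)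

    classB-n : Carmichael n → 2^ E ∥ N → ClassB n
    classB-n C E∥ = classB-intro λ-n (λ∣n∸1 C λ-n) (subst (2^_∥ N) (sym v2[λ]≡E) E∥)

    -- A prime factor q of n₁ with v2 (q - 1) = e₁ < E keeps h below the number of prime factors.
    classB1-n : Carmichael n → 2^ E ∥ N → e₁ < E → ClassB1 n
    classB1-n C E∥ e₁<E with ∃prime-v2[p∸1]≡v2[λ] C₁ λ₁
    ... | q , prime-q , q∣n₁ , v2≡e₁ =
      classB1-intro C λ-n (classB-n C E∥) prime-q (∣-trans q∣n₁ (m∣m*n n₂))
                    (λ v2≡ → <⇒≢ e₁<E (trans (sym v2≡e₁) (trans v2≡ v2[λ]≡E)))

    classB1-n′ : Carmichael n → 2^ E ∥ N → e₂ < E → ClassB1 n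
    classB1-n′ C E∥ e₂<E with ∃prime-v2[p∸1]≡v2[λ] C₂ λ₂
    ... | q , prime-q , q∣n₂ , v2≡e₂ =
      classB1-intro C λ-n (classB-n C E∥) prime-q (∣-trans q∣n₂ (n∣m*n n₁))
                    (λ v2≡ → <⇒≢ e₂<E (trans (sym v2≡e₂) (trans v2≡ v2[λ]≡E)))

    classA₁⇒e₁<a₁ : ClassA n₁ → e₁ < a₁
    classA₁⇒e₁<a₁ A = classA⇒v2[λ]< λ₁ A a₁∥
    classA₂⇒e₂<a₂ : ClassA n₂ → e₂ < a₂
    classA₂⇒e₂<a₂ A = classA⇒v2[λ]< λ₂ A a₂∥
    classB₁⇒e₁≡a₁ : ClassB n₁ → e₁ ≡ a₁
    classB₁⇒e₁≡a₁ B = classB⇒v2[λ]≡ λ₁ B a₁∥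
    classB₂⇒e₂≡a₂ : ClassB n₂ → e₂ ≡ a₂
    classB₂⇒e₂≡a₂ B = classB⇒v2[λ]≡ λ₂ B a₂∥

    a₁<a₂⇒e₂≤a₁ : Carmichael n → a₁ < a₂ → e₂ ≤ a₁
    a₁<a₂⇒e₂≤a₁ C a₁<a₂ = ≤-trans (m≤n⊔m e₁ e₂) (E≤ C (N-∥-< a₁<a₂))
    a₂<a₁⇒e₁≤a₂ : Carmichael n → a₂ < a₁ → e₁ ≤ a₂
    a₂<a₁⇒e₁≤a₂ C a₂<a₁ = ≤-trans (m≤m⊔n e₁ e₂) (E≤ C (N-∥-> a₂<a₁))

    2^[a₁⊓a₂]∣N : 2 ^ (a₁ ⊓ a₂) ∣ N
    2^[a₁⊓a₂]∣N with <-cmp a₁ a₂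
    ... | tri< a₁<a₂ _ _ = ∣-trans (^-monoʳ-∣ 2 (m⊓n≤m a₁ a₂)) (power∣ (N-∥-< a₁<a₂))
    ... | tri≈ _ a₁≡a₂ _ = ∣-trans (^-monoʳ-∣ 2 (≤-trans (m⊓n≤m a₁ a₂) (n≤1+n a₁))) (N-∣-≡ a₁≡a₂)
    ... | tri> _ _ a₂<a₁ = ∣-trans (^-monoʳ-∣ 2 (m⊓n≤n a₁ a₂)) (power∣ (N-∥-> a₂<a₁))

  E<a₁⊓a₂⇒classA : Carmichael n → E < a₁ ⊓ a₂ → ClassA n
  E<a₁⊓a₂⇒classA C E<a₁⊓a₂ = classA-n C (∣-trans (^-monoʳ-∣ 2 E<a₁⊓a₂) 2^[a₁⊓a₂]∣N)

  a₁≡a₂⇒classA : Carmichael n → e₁ ≤ a₁ → e₂ ≤ a₂ → a₁ ≡ a₂ → ClassA n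
  a₁≡a₂⇒classA C e₁≤a₁ e₂≤a₂ a₁≡a₂ =
    classA-n C (∣-trans (^-monoʳ-∣ 2 (s≤s (⊔-lub e₁≤a₁ (subst (e₂ ≤_) (sym a₁≡a₂) e₂≤a₂)))) (N-∣-≡ a₁≡a₂))

  classA·classA⇒classB1 : ClassA n₁ → ClassA n₂ → Carmichael n → a₁ ⊓ a₂ ≡ E → a₁ ≢ a₂ → ClassB1 n
  classA·classA⇒classB1 A₁ A₂ C a₁⊓a₂≡E a₁≢a₂ with <-cmp a₁ a₂
  ... | tri< a₁<a₂ _ _ = classB1-n C (subst (2^_∥ N) a₁≡E (N-∥-< a₁<a₂)) (subst (e₁ <_) a₁≡E (classA₁⇒e₁<a₁ A₁))
    where a₁≡E : a₁ ≡ E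
          a₁≡E = trans (sym (m≤n⇒m⊓n≡m (<⇒≤ a₁<a₂))) a₁⊓a₂≡E
  ... | tri≈ _ a₁≡a₂ _ = ⊥-elim (a₁≢a₂ a₁≡a₂)
  ... | tri> _ _ a₂<a₁ = classB1-n′ C (subst (2^_∥ N) a₂≡E (N-∥-> a₂<a₁)) (subst (e₂ <_) a₂≡E (classA₂⇒e₂<a₂ A₂))
    where a₂≡E : a₂ ≡ E
          a₂≡E = trans (sym (m≥n⇒m⊓n≡n (<⇒≤ a₂<a₁))) a₁⊓a₂≡E

  classA·classA⇒¬carmichael : ClassA n₁ → ClassA n₂ → ¬ (E < a₁ ⊓ a₂) → ¬ (a₁ ⊓ a₂ ≡ E × a₁ ≢ a₂) →
                              ¬ Carmichael n
  classA·classA⇒¬carmichael A₁ A₂ E≮a₁⊓a₂ ¬B1-case C with <-cmp a₁ a₂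
  ... | tri< a₁<a₂ _ _ = ¬B1-case (trans a₁⊓a₂≡a₁ (≤-antisym (≮⇒≥ E≮a₁) (E≤ C (N-∥-< a₁<a₂))) , <⇒≢ a₁<a₂)
    where
    a₁⊓a₂≡a₁ : a₁ ⊓ a₂ ≡ a₁
    a₁⊓a₂≡a₁ = m≤n⇒m⊓n≡m (<⇒≤ a₁<a₂)
    E≮a₁ : ¬ (E < a₁)
    E≮a₁ = λ E<a₁ → E≮a₁⊓a₂ (subst (E <_) (sym a₁⊓a₂≡a₁) E<a₁)
  ... | tri≈ _ a₁≡a₂ _ = E≮a₁⊓a₂ (subst (E <_) (sym (trans (cong (a₁ ⊓_) (sym a₁≡a₂)) (⊓-idem a₁)))
                                        (⊔-lub (classA₁⇒e₁<a₁ A₁) (subst (e₂ <_) (sym a₁≡a₂) (classA₂⇒e₂<a₂ A₂))))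
  ... | tri> _ _ a₂<a₁ = ¬B1-case (trans a₁⊓a₂≡a₂ (≤-antisym (≮⇒≥ E≮a₂) (E≤ C (N-∥-> a₂<a₁))) , >⇒≢ a₂<a₁)
    where
    a₁⊓a₂≡a₂ : a₁ ⊓ a₂ ≡ a₂
    a₁⊓a₂≡a₂ = m≥n⇒m⊓n≡n (<⇒≤ a₂<a₁)
    E≮a₂ : ¬ (E < a₂)
    E≮a₂ = λ E<a₂ → E≮a₁⊓a₂ (subst (E <_) (sym a₁⊓a₂≡a₂) E<a₂)

  classA·classB⇒classB1 : ClassA n₁ → ClassB n₂ → Carmichael n → a₂ < a₁ → e₁ < e₂ → ClassB1 n
  classA·classB⇒classB1 _ B₂ C a₂<a₁ e₁<e₂ =
    classB1-n C (subst (2^_∥ N) a₂≡E (N-∥-> a₂<a₁)) (subst (e₁ <_) (sym E≡e₂) e₁<e₂)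
    where
    E≡e₂ : E ≡ e₂
    E≡e₂ = m≤n⇒m⊔n≡n (<⇒≤ e₁<e₂)
    a₂≡E : a₂ ≡ E
    a₂≡E = trans (sym (classB₂⇒e₂≡a₂ B₂)) (sym E≡e₂)

  classB₂⇒classB1⊎B2 : ClassB n₂ → Carmichael n → a₂ < a₁ → e₁ ≡ e₂ → ClassB1 n ⊎ ClassB2 n
  classB₂⇒classB1⊎B2 B₂ C a₂<a₁ e₁≡e₂ = classB1⊎B2-intro C λ-n (classB-n C (subst (2^_∥ N) a₂≡E (N-∥-> a₂<a₁)))
    where
    a₂≡E : a₂ ≡ E
    a₂≡E = trans (sym (classB₂⇒e₂≡a₂ B₂)) (sym (trans (cong (_⊔ e₂) e₁≡e₂) (⊔-idem e₂)))

  classB₂⇒¬a₁<a₂ : ClassB n₂ → Carmichael n → ¬ (a₁ < a₂)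
  classB₂⇒¬a₁<a₂ B₂ C a₁<a₂ = <⇒≱ a₁<a₂ (subst (_≤ a₁) (classB₂⇒e₂≡a₂ B₂) (a₁<a₂⇒e₂≤a₁ C a₁<a₂))

  classB₁⇒¬a₂<a₁ : ClassB n₁ → Carmichael n → ¬ (a₂ < a₁)
  classB₁⇒¬a₂<a₁ B₁ C a₂<a₁ = <⇒≱ a₂<a₁ (subst (_≤ a₂) (classB₁⇒e₁≡a₁ B₁) (a₂<a₁⇒e₁≤a₂ C a₂<a₁))

  classA·classB⇒¬carmichael : ClassA n₁ → ClassB n₂ → a₁ ≢ a₂ → ¬ (a₂ < a₁ × e₁ < e₂) → ¬ (a₂ < a₁ × e₁ ≡ e₂) →
                              ¬ Carmichael n
  classA·classB⇒¬carmichael _ B₂ a₁≢a₂ ¬B1-case ¬B1⊎B2-case C with <-cmp a₁ a₂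
  ... | tri< a₁<a₂ _ _ = classB₂⇒¬a₁<a₂ B₂ C a₁<a₂
  ... | tri≈ _ a₁≡a₂ _ = a₁≢a₂ a₁≡a₂
  ... | tri> _ _ a₂<a₁ with <-cmp e₁ e₂
  ...   | tri< e₁<e₂ _ _ = ¬B1-case (a₂<a₁ , e₁<e₂)
  ...   | tri≈ _ e₁≡e₂ _ = ¬B1⊎B2-case (a₂<a₁ , e₁≡e₂)
  ...   | tri> _ _ e₂<e₁ = <⇒≱ e₂<e₁ (subst (e₁ ≤_) (sym (classB₂⇒e₂≡a₂ B₂)) (a₂<a₁⇒e₁≤a₂ C a₂<a₁))

  classB·classB⇒¬carmichael : ClassB n₁ → ClassB n₂ → a₁ ≢ a₂ → ¬ Carmichael n
  classB·classB⇒¬carmichael B₁ B₂ a₁≢a₂ C with <-cmp a₁ a₂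
  ... | tri< a₁<a₂ _ _ = classB₂⇒¬a₁<a₂ B₂ C a₁<a₂
  ... | tri≈ _ a₁≡a₂ _ = a₁≢a₂ a₁≡a₂
  ... | tri> _ _ a₂<a₁ = classB₁⇒¬a₂<a₁ B₁ C a₂<a₁

  classA·classB⇒classA : ClassA n₁ → ClassB n₂ → Carmichael n → a₁ ≡ a₂ → ClassA n
  classA·classB⇒classA A₁ B₂ C = a₁≡a₂⇒classA C (<⇒≤ (classA₁⇒e₁<a₁ A₁)) (≤-reflexive (classB₂⇒e₂≡a₂ B₂))

  classB·classB⇒classA : ClassB n₁ → ClassB n₂ → Carmichael n → a₁ ≡ a₂ → ClassA n
  classB·classB⇒classA B₁ B₂ C = a₁≡a₂⇒classA C (≤-reflexive (classB₁⇒e₁≡a₁ B₁)) (≤-reflexive (classB₂⇒e₂≡a₂ B₂))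

mainTheorem5 : ∀ n₁ n₂ ℓ₁ ℓ₂ → Carmichael n₁ → Carmichael n₂ → Coprime n₁ n₂
  → IsLambda n₁ ℓ₁ → IsLambda n₂ ℓ₂
  →
    -- (i) both in class A
    ((ClassA n₁ → ClassA n₂ → Carmichael (n₁ * n₂) → (v2 ℓ₁) ⊔ (v2 ℓ₂) < (v2 (n₁ ∸ 1)) ⊓ (v2 (n₂ ∸ 1)) → ClassA (n₁ * n₂))
    × (ClassA n₁ → ClassA n₂ → Carmichael (n₁ * n₂) → (v2 (n₁ ∸ 1)) ⊓ (v2 (n₂ ∸ 1)) ≡ (v2 ℓ₁) ⊔ (v2 ℓ₂) → (v2 (n₁ ∸ 1)) ≢ (v2 (n₂ ∸ 1)) → ClassB1 (n₁ * n₂))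
    × (ClassA n₁ → ClassA n₂ → ¬ ((v2 ℓ₁) ⊔ (v2 ℓ₂) < (v2 (n₁ ∸ 1)) ⊓ (v2 (n₂ ∸ 1)))
         → ¬ ((v2 (n₁ ∸ 1)) ⊓ (v2 (n₂ ∸ 1)) ≡ (v2 ℓ₁) ⊔ (v2 ℓ₂) × (v2 (n₁ ∸ 1)) ≢ (v2 (n₂ ∸ 1))) → ¬ Carmichael (n₁ * n₂)))
    -- (ii) n₁ in class A, n₂ in class B
    × ((ClassA n₁ → ClassB n₂ → Carmichael (n₁ * n₂) → (v2 (n₁ ∸ 1)) ≡ (v2 (n₂ ∸ 1)) → ClassA (n₁ * n₂))
    × (ClassA n₁ → ClassB n₂ → Carmichael (n₁ * n₂) → (v2 (n₂ ∸ 1)) < (v2 (n₁ ∸ 1)) → (v2 ℓ₁) < (v2 ℓ₂) → ClassB1 (n₁ * n₂))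
    × (ClassA n₁ → ClassB n₂ → Carmichael (n₁ * n₂) → (v2 (n₂ ∸ 1)) < (v2 (n₁ ∸ 1)) → (v2 ℓ₁) ≡ (v2 ℓ₂) → ClassB1 (n₁ * n₂) ⊎ ClassB2 (n₁ * n₂))
    × (ClassA n₁ → ClassB n₂ → (v2 (n₁ ∸ 1)) ≢ (v2 (n₂ ∸ 1)) → ¬ ((v2 (n₂ ∸ 1)) < (v2 (n₁ ∸ 1)) × (v2 ℓ₁) < (v2 ℓ₂))
         → ¬ ((v2 (n₂ ∸ 1)) < (v2 (n₁ ∸ 1)) × (v2 ℓ₁) ≡ (v2 ℓ₂)) → ¬ Carmichael (n₁ * n₂)))
    -- (iii) both in class B
    × ((ClassB n₁ → ClassB n₂ → Carmichael (n₁ * n₂) → (v2 (n₁ ∸ 1)) ≡ (v2 (n₂ ∸ 1)) → ClassA (n₁ * n₂))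
    × (ClassB n₁ → ClassB n₂ → (v2 (n₁ ∸ 1)) ≢ (v2 (n₂ ∸ 1)) → ¬ Carmichael (n₁ * n₂)))
mainTheorem5 n₁ n₂ ℓ₁ ℓ₂ C₁ C₂ n₁⊥n₂ λ₁ λ₂ =
  ( (λ _ _ → E<a₁⊓a₂⇒classA) , classA·classA⇒classB1 , classA·classA⇒¬carmichael )
  , ( classA·classB⇒classA , classA·classB⇒classB1 , (λ _ → classB₂⇒classB1⊎B2) , classA·classB⇒¬carmichael )
  , ( classB·classB⇒classA , classB·classB⇒¬carmichael )
  where open CoprimeProduct C₁ C₂ n₁⊥n₂ λ₁ λ₂
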